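{- Let $\alpha=2\sqrt3-3$ and $\gamma=\frac{3-\sqrt3}{2}$. For every $\xi>0$ there exist $\delta>0$ and $n_0$ such that the following holds for all $n\ge n_0$. Suppose that $G$ is an $n$-vertex graph and $V(G)=V_1\cup V_2$ is a partition such that (i) the number of type-1 four-vertex paths in $G$ and the number of type-2 four-vertex paths in $G$ are each at most $\delta n^4$; (ii) $\big||V_1|-\gamma n\big|\le\delta n$; and (iii) $|G[V_2]|\le\left(\frac\alpha2+\delta\right)|V_2|^2$. Then $|G|\le\left(\frac\alpha2+\xi\right)n^2$. Moreover, if $|G|\ge\left(\frac\alpha2-\delta\right)n^2$, then either $|G[V_1,V_2]|\le\xi n^2$ or $|G[V_1]|+|G[V_2]|\le\xi n^2$.
   Context: $|G|$ denotes the number of edges of a graph $G$; $G[S]$ is the induced subgraph on $S$ and $G[V_1,V_2]$ is the bipartite subgraph of edges with one endpoint in $V_1$ and one in $V_2$. A four-vertex path is an ordered $4$-tuple $(a,b,c,d)$ of distinct vertices with $ab,bc,cd\in G$. It is of type-1 (with respect to $(V_1,V_2)$) if $a,b,c\in V_1$ and $d\in V_2$, and of type-2 if $a,d\in V_1$ and $b,c\in V_2$.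
   Formalization: The parameter ξ ranges over the positive rationals, and the witness δ is taken in the positive rationals as well. -}

module Defs where

open import Data.Nat as ℕ using (ℕ)
open import Data.Integer as ℤ using (+_)
open import Data.Rational as ℚ using (ℚ; 0ℚ; _/_)
open import Data.Bool using (Bool; true; false; if_then_else_; _∧_; not)
open import Data.Fin using (Fin; _<?_; _≟_)
open import Data.List using (List; map)
open import Data.Nat.ListAction using (sum)
open import Data.Fin.Properties using ()
open import Data.List using (allFin)
open import Relation.Nullary.Decidable using (⌊_⌋)
open import Relation.Binary.PropositionalEquality using (_≡_)
open import Data.Product using (_×_)
open import Data.Sum using (_⊎_)

record Graph (n : ℕ) : Set where
  field
    adj    : Fin n → Fin n → Bool
    sym    : ∀ i j → adj i j ≡ adj j i
    irrefl : ∀ i → adj i i ≡ false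
open Graph public

countFin : (n : ℕ) → (Fin n → Bool) → ℕ
countFin n p = sum (map (λ i → if p i then 1 else 0) (allFin n))

countFin² : (n : ℕ) → (Fin n → Fin n → Bool) → ℕ
countFin² n p = sum (map (λ i → countFin n (p i)) (allFin n))

countFin⁴ : (n : ℕ) → (Fin n → Fin n → Fin n → Fin n → Bool) → ℕ
countFin⁴ n p =
  sum (map (λ a → sum (map (λ b → sum (map (λ c → countFin n (p a b c))
    (allFin n))) (allFin n))) (allFin n))

lt : {n : ℕ} → Fin n → Fin n → Bool
lt i j = ⌊ i <? j ⌋

neq : {n : ℕ} → Fin n → Fin n → Bool
neq i j = not ⌊ i ≟ j ⌋

-- A partition V(G) = V₁ ∪ V₂ is given by  inV₁ : Fin n → Bool
-- (V₁ = {v | inV₁ v ≡ true}, V₂ = its complement).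

edges : {n : ℕ} → Graph n → ℕ
edges {n} G = countFin² n (λ i j → lt i j ∧ adj G i j)

edgesIn : {n : ℕ} → Graph n → (Fin n → Bool) → ℕ
edgesIn {n} G S = countFin² n (λ i j → lt i j ∧ adj G i j ∧ S i ∧ S j)

edgesBetween : {n : ℕ} → Graph n → (Fin n → Bool) → ℕ
edgesBetween {n} G V₁ = countFin² n (λ i j → adj G i j ∧ V₁ i ∧ not (V₁ j))

isP4 : {n : ℕ} → Graph n → Fin n → Fin n → Fin n → Fin n → Bool
isP4 G a b c d =
  neq a b ∧ neq a c ∧ neq a d ∧ neq b c ∧ neq b d ∧ neq c d ∧
  adj G a b ∧ adj G b c ∧ adj G c d

paths₁ : {n : ℕ} → Graph n → (Fin n → Bool) → ℕ
paths₁ {n} G V₁ = countFin⁴ n (λ a b c d →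
  isP4 G a b c d ∧ V₁ a ∧ V₁ b ∧ V₁ c ∧ not (V₁ d))

paths₂ : {n : ℕ} → Graph n → (Fin n → Bool) → ℕ
paths₂ {n} G V₁ = countFin⁴ n (λ a b c d →
  isP4 G a b c d ∧ V₁ a ∧ not (V₁ b) ∧ not (V₁ c) ∧ V₁ d)

-- The ordered field ℚ(√3) ⊂ ℝ: the element  re + im·√3.
-- (All real numbers occurring in the statement lie in this field.)

record ℚ√3 : Set where
  constructor _+_√3
  field
    re : ℚ
    im : ℚ
open ℚ√3 public

infixl 6 _⊕_ _⊖_
infixl 7 _⊗_
infix 4 _≼_

_⊕_ : ℚ√3 → ℚ√3 → ℚ√3
(a + b √3) ⊕ (c + d √3) = (a ℚ.+ c) + (b ℚ.+ d) √3

⊝_ : ℚ√3 → ℚ√3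
⊝ (a + b √3) = (ℚ.- a) + (ℚ.- b) √3

_⊖_ : ℚ√3 → ℚ√3 → ℚ√3
x ⊖ y = x ⊕ (⊝ y)

_⊗_ : ℚ√3 → ℚ√3 → ℚ√3
(a + b √3) ⊗ (c + d √3) =
  ((a ℚ.* c) ℚ.+ ((+ 3 / 1) ℚ.* (b ℚ.* d))) + ((a ℚ.* d) ℚ.+ (b ℚ.* c)) √3

ι : ℚ → ℚ√3
ι q = q + 0ℚ √3

ιℕ : ℕ → ℚ√3
ιℕ k = ι (+ k / 1)

-- a + b√3 ≥ 0 (as a real number)
NonNeg : ℚ√3 → Set
NonNeg (a + b √3) =
  (0ℚ ℚ.≤ a × 0ℚ ℚ.≤ b) ⊎
  (0ℚ ℚ.≤ a × b ℚ.< 0ℚ × (+ 3 / 1) ℚ.* (b ℚ.* b) ℚ.≤ a ℚ.* a) ⊎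
  (a ℚ.< 0ℚ × 0ℚ ℚ.≤ b × a ℚ.* a ℚ.≤ (+ 3 / 1) ℚ.* (b ℚ.* b))

_≼_ : ℚ√3 → ℚ√3 → Set
x ≼ y = NonNeg (y ⊖ x)

α : ℚ√3
α = ((ℤ.- (+ 3)) / 1) + (+ 2 / 1) √3

α/2 : ℚ√3
α/2 = α ⊗ ι (+ 1 / 2)

γ : ℚ√3
γ = (+ 3 / 2) + ((ℤ.- (+ 1)) / 2) √3

{-# OPTIONS --safe #-}
module Submission where

-- Fix a degree threshold T ≈ n/M.  Call a vertex of V₁ high (H₁) if it has at least
-- T neighbours in V₂ and low (L₁) otherwise, and a vertex of V₂ high (H₂) if it has more than T
-- neighbours in V₁ and low (L₂) otherwise.  An edge of G[V₁] from a vertex with many neighbours in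
-- V₁ to a vertex of H₁ is the middle edge of about T² type-1 paths, and an edge inside H₂ is the
-- middle edge of about T² type-2 paths.  As such paths are rare, up to o(n²) edges G[V₁] lies
-- inside L₁, G[V₁,V₂] lies between H₁ and H₂, and every edge of G[V₂] meets L₂.  With l, h, l₂, h₂
-- the sizes of the four classes, k = l + h and m = l₂ + h₂, this yields
--   k·2|G| + k·l·h + 2·h·(k − m)·l₂ ≤ k·α·n² + o(n³),
-- because |G[V₂]| ≲ αm²/2 and |V₁| ≈ γn give k² + 2|G[V₂]| ≲ αn² and 2km ≲ αn² (γn is the
-- size of V₁ at which both are tight).  This bounds |G|; and if |G| ≈ αn²/2 the slack forces
-- l·h ≈ 0 and h·l₂ ≈ 0, so either h is small and G[V₁,V₂] has few edges, or l and l₂ are small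
-- and G[V₁], G[V₂] have few edges.  The irrational constants are handled by bracketing √3
-- between rationals u ≤ √3 ≤ v.

module FiniteSums where

  open import Data.Nat.Base using (ℕ; zero; suc; _+_; _*_; _≤_; z≤n; s≤s)
  open import Data.Nat.Properties
    using (+-*-semiring; +-mono-≤; ≤-trans; ≤-reflexive; *-identityʳ; +-identityʳ; *-zeroʳ; module ≤-Reasoning)
  import Data.Fin.Properties as Fin
  open import Data.Product using (_×_; _,_)
  open import Relation.Nullary using (yes; no)
  open import Relation.Nullary.Decidable using (⌊_⌋)
  open import Data.Bool.Base using (Bool; true; false; if_then_else_; not; _∧_)
  open import Data.Fin.Base using (Fin; zero; suc)
  open import Data.List.Base using (map; tabulate; allFin)
  open import Data.List.Properties using (map-tabulate)
  import Data.Nat.ListAction as List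
  open import Function.Base using (_∘_; id)
  open import Relation.Binary.PropositionalEquality
  open import Defs using (neq)
  open import Algebra.Properties.Semiring.Sum +-*-semiring public
    using (sum; sum-syntax; ∑-distrib-+; ∑-comm; *-distribˡ-sum; *-distribʳ-sum; sum-cong-≗)

  χ : Bool → ℕ
  χ b = if b then 1 else 0

  χ-not : ∀ b → χ b + χ (not b) ≡ 1
  χ-not true  = refl
  χ-not false = refl

  infixr 6 _&_

  _&_ : ∀ {x y} → x ≡ true → y ≡ true → x ∧ y ≡ true
  refl & refl = refl

  ∧-true : ∀ {x y} → x ∧ y ≡ true → x ≡ true × y ≡ true
  ∧-true {true} y≡true = refl , y≡true

  χ*χ≤χ : ∀ {x y z} → (x ≡ true → y ≡ true → z ≡ true) → χ x * χ y ≤ χ z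
  χ*χ≤χ {false}               _ = z≤n
  χ*χ≤χ {true}  {false}       _ = z≤n
  χ*χ≤χ {true}  {true}  {z} x⇒z with z | x⇒z refl refl
  ... | true | refl = s≤s z≤n

  list-sum≡∑ : ∀ n (f : Fin n → ℕ) → List.sum (map f (allFin n)) ≡ ∑[ i < n ] f i
  list-sum≡∑ n f = trans (cong List.sum (map-tabulate id f)) (sum-tabulate n f)
    where
    sum-tabulate : ∀ n (f : Fin n → ℕ) → List.sum (tabulate f) ≡ ∑[ i < n ] f i
    sum-tabulate zero    f = refl
    sum-tabulate (suc n) f = cong (f zero +_) (sum-tabulate n (f ∘ suc))

  ∑-mono-≤ : ∀ {n} {f g : Fin n → ℕ} → (∀ i → f i ≤ g i) → ∑[ i < n ] f i ≤ ∑[ i < n ] g i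
  ∑-mono-≤ {zero}  f≤g = z≤n
  ∑-mono-≤ {suc n} f≤g = +-mono-≤ (f≤g zero) (∑-mono-≤ (f≤g ∘ suc))

  ∑-const : ∀ n c → ∑[ i < n ] c ≡ n * c
  ∑-const zero    c = refl
  ∑-const (suc n) c = cong (c +_) (∑-const n c)

  ∑-≤-const : ∀ {n c} {f : Fin n → ℕ} → (∀ i → f i ≤ c) → ∑[ i < n ] f i ≤ n * c
  ∑-≤-const {n} {c} f≤c = ≤-trans (∑-mono-≤ f≤c) (≤-reflexive (∑-const n c))

  ∑χ-complement : ∀ n (p : Fin n → Bool) → ∑[ i < n ] χ (p i) + ∑[ i < n ] χ (not (p i)) ≡ n
  ∑χ-complement n p = begin
    ∑[ i < n ] χ (p i) + ∑[ i < n ] χ (not (p i)) ≡⟨ ∑-distrib-+ (χ ∘ p) (χ ∘ not ∘ p) ⟨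
    ∑[ i < n ] (χ (p i) + χ (not (p i)))           ≡⟨ sum-cong-≗ (χ-not ∘ p) ⟩
    ∑[ i < n ] 1                                   ≡⟨ ∑-const n 1 ⟩
    n * 1                                          ≡⟨ *-identityʳ n ⟩
    n                                              ∎
    where open ≡-Reasoning

  ∑∑ : ∀ {n} → (Fin n → Fin n → ℕ) → ℕ
  ∑∑ {n} f = ∑[ i < n ] ∑[ j < n ] f i j

  ∑∑-mono-≤ : ∀ {n} {f g : Fin n → Fin n → ℕ} → (∀ i j → f i j ≤ g i j) → ∑∑ f ≤ ∑∑ g
  ∑∑-mono-≤ f≤g = ∑-mono-≤ λ i → ∑-mono-≤ (f≤g i)

  ∑∑-distrib-+ : ∀ {n} (f g : Fin n → Fin n → ℕ) → ∑∑ (λ i j → f i j + g i j) ≡ ∑∑ f + ∑∑ g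
  ∑∑-distrib-+ {n} f g = trans (sum-cong-≗ λ i → ∑-distrib-+ (f i) (g i))
    (∑-distrib-+ (λ i → ∑[ j < n ] f i j) (λ i → ∑[ j < n ] g i j))

  infixl 6 _+ᶠ_

  _+ᶠ_ : ∀ {n} (f g : Fin n → Fin n → ℕ) → Fin n → Fin n → ℕ
  (f +ᶠ g) i j = f i j + g i j

  _ᵀ : ∀ {n} → (Fin n → Fin n → ℕ) → Fin n → Fin n → ℕ
  (f ᵀ) i j = f j i

  ∑∑-transpose : ∀ {n} (f : Fin n → Fin n → ℕ) → ∑∑ (f ᵀ) ≡ ∑∑ f
  ∑∑-transpose f = ∑-comm (f ᵀ)

  ∑∑-distrib-+₃ : ∀ {n} (f g h : Fin n → Fin n → ℕ) → ∑∑ (f +ᶠ g +ᶠ h) ≡ ∑∑ f + ∑∑ g + ∑∑ h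
  ∑∑-distrib-+₃ f g h = trans (∑∑-distrib-+ (f +ᶠ g) h) (cong (_+ ∑∑ h) (∑∑-distrib-+ f g))

  ∑∑-symmetrize : ∀ {n} (f : Fin n → Fin n → ℕ) → ∑∑ (f +ᶠ f ᵀ) ≡ 2 * ∑∑ f
  ∑∑-symmetrize f = trans (∑∑-distrib-+ f (f ᵀ))
    (trans (cong (∑∑ f +_) (∑∑-transpose f)) (cong (∑∑ f +_) (sym (+-identityʳ (∑∑ f)))))

  ∑∑-product : ∀ {n} (f g : Fin n → ℕ) → ∑∑ (λ i j → f i * g j) ≡ (∑[ i < n ] f i) * (∑[ j < n ] g j)
  ∑∑-product {n} f g = begin
    ∑[ i < n ] ∑[ j < n ] (f i * g j) ≡⟨ sum-cong-≗ (λ i → *-distribˡ-sum (f i) g) ⟨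
    ∑[ i < n ] (f i * ∑[ j < n ] g j) ≡⟨ *-distribʳ-sum (∑[ j < n ] g j) f ⟨
    (∑[ i < n ] f i) * (∑[ j < n ] g j) ∎
    where open ≡-Reasoning

  ∑-indicator : ∀ {n} (c : Fin n) → ∑[ a < n ] χ ⌊ a Fin.≟ c ⌋ ≡ 1
  ∑-indicator (zero {n}) = cong (1 +_) (trans (∑-const n 0) (*-zeroʳ n))
  ∑-indicator (suc c)    = trans (sum-cong-≗ λ a → cong χ (≟-suc a)) (∑-indicator c)
    where
    ≟-suc : ∀ a → ⌊ suc a Fin.≟ suc c ⌋ ≡ ⌊ a Fin.≟ c ⌋
    ≟-suc a with a Fin.≟ c
    ... | yes _ = refl
    ... | no _  = refl

  ∑-drop-one : ∀ {n} (P : Fin n → Bool) (c : Fin n) → ∑[ a < n ] χ (P a) ≤ ∑[ a < n ] χ (P a ∧ neq a c) + 1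
  ∑-drop-one {n} P c = begin
    ∑[ a < n ] χ (P a)                                          ≤⟨ ∑-mono-≤ pointwise ⟩
    ∑[ a < n ] (χ (P a ∧ neq a c) + χ ⌊ a Fin.≟ c ⌋)            ≡⟨ ∑-distrib-+ (λ a → χ (P a ∧ neq a c)) (λ a → χ ⌊ a Fin.≟ c ⌋) ⟩
    ∑[ a < n ] χ (P a ∧ neq a c) + ∑[ a < n ] χ ⌊ a Fin.≟ c ⌋   ≡⟨ cong (∑[ a < n ] χ (P a ∧ neq a c) +_) (∑-indicator c) ⟩
    ∑[ a < n ] χ (P a ∧ neq a c) + 1                            ∎
    where
    open ≤-Reasoning
    pointwise : ∀ a → χ (P a) ≤ χ (P a ∧ neq a c) + χ ⌊ a Fin.≟ c ⌋
    pointwise a with P a | a Fin.≟ c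
    ... | false | _     = z≤n
    ... | true  | yes _ = s≤s z≤n
    ... | true  | no _  = s≤s z≤n

  ∑∑-rows-≤ : ∀ {n T} (b : Fin n → Bool) (P : Fin n → Fin n → Bool) →
    (∀ v → b v ≡ true → ∑[ u < n ] χ (P v u) ≤ T) → ∑∑ (λ v u → χ (b v) * χ (P v u)) ≤ n * T
  ∑∑-rows-≤ {n} {T} b P row≤ =
    ≤-trans (≤-reflexive (sum-cong-≗ λ v → sym (*-distribˡ-sum (χ (b v)) (χ ∘ P v)))) (∑-≤-const bounded)
    where
    bounded : ∀ v → χ (b v) * ∑[ u < n ] χ (P v u) ≤ T
    bounded v with b v in bv
    ... | false = z≤n
    ... | true  = ≤-trans (≤-reflexive (+-identityʳ _)) (row≤ v bv)

  ∑∑-*ʳ : ∀ {n} (f : Fin n → Fin n → ℕ) c → ∑∑ f * c ≡ ∑∑ (λ i j → f i j * c)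
  ∑∑-*ʳ {n} f c = trans (*-distribʳ-sum c (λ i → ∑[ j < n ] f i j)) (sum-cong-≗ λ i → *-distribʳ-sum c (f i))

  ∑⁴ : ∀ {n} → (Fin n → Fin n → Fin n → Fin n → ℕ) → ℕ
  ∑⁴ {n} F = ∑[ a < n ] ∑[ b < n ] ∑[ c < n ] ∑[ d < n ] F a b c d

  ∑⁴-middle-first : ∀ {n} (F : Fin n → Fin n → Fin n → Fin n → ℕ) →
    ∑⁴ F ≡ ∑∑ (λ b c → ∑∑ (λ a d → F a b c d))
  ∑⁴-middle-first {n} F = trans (∑-comm (λ a b → ∑[ c < n ] ∑[ d < n ] F a b c d))
    (sum-cong-≗ λ b → ∑-comm (λ a c → ∑[ d < n ] F a b c d))

module GraphCounting where

  open import Data.Nat.Base using (ℕ; _+_; _*_; _≤_; _<_; z≤n; s≤s)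
  open import Data.Nat.Properties as ℕ
    using (_<?_; _≤?_; ≤-trans; ≤-reflexive; ≮⇒≥; ≰⇒>; <⇒≤; +-mono-≤; +-monoˡ-≤; *-monoʳ-≤; +-identityʳ; +-assoc)
  open import Data.Bool.Properties using (∧-comm; ∧-conicalʳ)
  open import Data.Bool.Base using (Bool; true; false; not; _∧_)
  open import Data.Fin.Base using (Fin)
  open import Data.Fin.Properties as Fin using (<-cmp; <-asym)
  open import Data.Empty using (⊥-elim)
  open import Relation.Nullary using (yes; no)
  open import Relation.Nullary.Decidable using (⌊_⌋)
  open import Function.Base using (_∘_)
  open import Data.Product using (_,_; proj₁; proj₂)
  open import Relation.Binary.Definitions using (tri<; tri≈; tri>)
  open import Relation.Binary.PropositionalEquality
  open import Defs using (Graph; adj; countFin; countFin²; countFin⁴; lt; neq; isP4; edges; edgesIn; edgesBetween; paths₁; paths₂)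
  open FiniteSums
  open import Data.Nat.Solver using (module +-*-Solver)
  open +-*-Solver using (solve; _:+_; _:*_; _:=_; con)

  pairs : ∀ {n} → (Fin n → Fin n → Bool) → ℕ
  pairs P = ∑∑ (λ i j → χ (P i j))

  countFin≡∑ : ∀ n (p : Fin n → Bool) → countFin n p ≡ ∑[ i < n ] χ (p i)
  countFin≡∑ n p = list-sum≡∑ n (χ ∘ p)

  countFin²≡pairs : ∀ n (P : Fin n → Fin n → Bool) → countFin² n P ≡ pairs P
  countFin²≡pairs n P = trans (list-sum≡∑ n _) (sum-cong-≗ λ i → countFin≡∑ n (P i))

  pairs-transpose : ∀ {n} (P : Fin n → Fin n → Bool) → pairs (λ i j → P j i) ≡ pairs P
  pairs-transpose P = ∑∑-transpose (λ i j → χ (P i j))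

  pairs-cong : ∀ {n} {P Q : Fin n → Fin n → Bool} → (∀ i j → P i j ≡ Q i j) → pairs P ≡ pairs Q
  pairs-cong P≡Q = sum-cong-≗ λ i → sum-cong-≗ λ j → cong χ (P≡Q i j)

  2*pairs-lt : ∀ {n} (P : Fin n → Fin n → Bool) → (∀ i j → P i j ≡ P j i) → (∀ i → P i i ≡ false) →
    2 * pairs (λ i j → lt i j ∧ P i j) ≡ pairs P
  2*pairs-lt {n} P P-sym P-irrefl = begin
    2 * S                                           ≡⟨ cong (S +_) (+-identityʳ S) ⟩
    S + S                                           ≡⟨ cong (S +_) (pairs-transpose (λ i j → lt i j ∧ P i j)) ⟨
    S + pairs (λ i j → lt j i ∧ P j i)             ≡⟨ cong (S +_) (pairs-cong λ i j → cong (lt j i ∧_) (P-sym j i)) ⟩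
    S + pairs (λ i j → lt j i ∧ P i j)             ≡⟨ ∑∑-distrib-+ (λ i j → χ (lt i j ∧ P i j)) (λ i j → χ (lt j i ∧ P i j)) ⟨
    ∑∑ (λ i j → χ (lt i j ∧ P i j) + χ (lt j i ∧ P i j)) ≡⟨ sum-cong-≗ (λ i → sum-cong-≗ λ j → split i j) ⟩
    pairs P                                         ∎
    where
    open ≡-Reasoning
    S = pairs (λ i j → lt i j ∧ P i j)
    split : ∀ i j → χ (lt i j ∧ P i j) + χ (lt j i ∧ P i j) ≡ χ (P i j)
    split i j with i Fin.<? j | j Fin.<? i
    ... | yes i<j | yes j<i = ⊥-elim (<-asym i<j j<i)
    ... | yes _   | no _    = +-identityʳ _
    ... | no _    | yes _   = refl
    ... | no i≮j  | no j≮i with <-cmp i j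
    ...   | tri< i<j _ _  = ⊥-elim (i≮j i<j)
    ...   | tri> _ _ j<i  = ⊥-elim (j≮i j<i)
    ...   | tri≈ _ refl _ = sym (cong χ (P-irrefl i))

  module Partition {n : ℕ} (G : Graph n) (V₁ : Fin n → Bool) where

    V₂ : Fin n → Bool
    V₂ v = not (V₁ v)

    e₁₁ e₁₂ e₂₂ : ℕ
    e₁₁ = pairs (λ i j → adj G i j ∧ V₁ i ∧ V₁ j)
    e₁₂ = pairs (λ i j → adj G i j ∧ V₁ i ∧ V₂ j)
    e₂₂ = pairs (λ i j → adj G i j ∧ V₂ i ∧ V₂ j)

    2*edgesIn : ∀ S → 2 * edgesIn G S ≡ pairs (λ i j → adj G i j ∧ S i ∧ S j)
    2*edgesIn S = trans (cong (2 *_) (countFin²≡pairs n _)) (2*pairs-lt _ symmetric irreflexive)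
      where
      symmetric : ∀ i j → adj G i j ∧ S i ∧ S j ≡ adj G j i ∧ S j ∧ S i
      symmetric i j = cong₂ _∧_ (Graph.sym G i j) (∧-comm (S i) (S j))
      irreflexive : ∀ i → adj G i i ∧ S i ∧ S i ≡ false
      irreflexive i rewrite Graph.irrefl G i = refl

    edgesBetween≡e₁₂ : edgesBetween G V₁ ≡ e₁₂
    edgesBetween≡e₁₂ = countFin²≡pairs n _

    2*edges : 2 * edges G ≡ e₁₁ + 2 * e₁₂ + e₂₂
    2*edges = begin
      2 * edges G                                            ≡⟨ cong (2 *_) (countFin²≡pairs n _) ⟩
      2 * pairs (λ i j → lt i j ∧ adj G i j)                 ≡⟨ 2*pairs-lt (adj G) (Graph.sym G) (Graph.irrefl G) ⟩
      pairs (adj G)                                          ≡⟨ sum-cong-≗ (λ i → sum-cong-≗ λ j → split (adj G i j) (V₁ i) (V₁ j)) ⟩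
      ∑∑ (λ i j → χ (A₁₁ i j) + χ (A₁₂ i j) + χ (A₂₁ i j) + χ (A₂₂ i j))
        ≡⟨ ∑∑-distrib-+₄ ⟩
      e₁₁ + e₁₂ + pairs A₂₁ + e₂₂                            ≡⟨ cong (λ e → e₁₁ + e₁₂ + e + e₂₂) e₂₁≡e₁₂ ⟩
      e₁₁ + e₁₂ + e₁₂ + e₂₂                                  ≡⟨ cong (_+ e₂₂) (+-assoc e₁₁ e₁₂ e₁₂) ⟩
      e₁₁ + (e₁₂ + e₁₂) + e₂₂                                ≡⟨ cong (λ e → e₁₁ + (e₁₂ + e) + e₂₂) (+-identityʳ e₁₂) ⟨
      e₁₁ + 2 * e₁₂ + e₂₂                                    ∎
      where
      open ≡-Reasoning
      A₁₁ A₁₂ A₂₁ A₂₂ : Fin n → Fin n → Bool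
      A₁₁ i j = adj G i j ∧ V₁ i ∧ V₁ j
      A₁₂ i j = adj G i j ∧ V₁ i ∧ V₂ j
      A₂₁ i j = adj G i j ∧ V₂ i ∧ V₁ j
      A₂₂ i j = adj G i j ∧ V₂ i ∧ V₂ j
      ∑∑-distrib-+₄ : ∑∑ (λ i j → χ (A₁₁ i j) + χ (A₁₂ i j) + χ (A₂₁ i j) + χ (A₂₂ i j))
                      ≡ e₁₁ + e₁₂ + pairs A₂₁ + e₂₂
      ∑∑-distrib-+₄ = begin
        _ ≡⟨ ∑∑-distrib-+ (λ i j → χ (A₁₁ i j) + χ (A₁₂ i j) + χ (A₂₁ i j)) (λ i j → χ (A₂₂ i j)) ⟩
        _ ≡⟨ cong (_+ e₂₂) (∑∑-distrib-+ (λ i j → χ (A₁₁ i j) + χ (A₁₂ i j)) (λ i j → χ (A₂₁ i j))) ⟩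
        _ ≡⟨ cong (λ e → e + pairs A₂₁ + e₂₂) (∑∑-distrib-+ (λ i j → χ (A₁₁ i j)) (λ i j → χ (A₁₂ i j))) ⟩
        _ ∎
      split : ∀ a x y → χ a ≡ χ (a ∧ x ∧ y) + χ (a ∧ x ∧ not y) + χ (a ∧ not x ∧ y) + χ (a ∧ not x ∧ not y)
      split false _     _     = refl
      split true  true  true  = refl
      split true  true  false = refl
      split true  false true  = refl
      split true  false false = refl
      e₂₁≡e₁₂ : pairs A₂₁ ≡ e₁₂
      e₂₁≡e₁₂ = trans (sym (pairs-transpose A₂₁))
        (pairs-cong λ i j → cong₂ _∧_ (Graph.sym G j i) (∧-comm (V₂ j) (V₁ i)))

    P₁ P₂ : Fin n → Fin n → Fin n → Fin n → Bool
    P₁ a b c d = isP4 G a b c d ∧ V₁ a ∧ V₁ b ∧ V₁ c ∧ V₂ d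
    P₂ a b c d = isP4 G a b c d ∧ V₁ a ∧ V₂ b ∧ V₂ c ∧ V₁ d

    private
      neq-true : ∀ {x y : Fin n} → x ≢ y → neq x y ≡ true
      neq-true {x} {y} x≢y with x Fin.≟ y
      ... | yes x≡y = ⊥-elim (x≢y x≡y)
      ... | no _    = refl

      adj⇒≢ : ∀ {x y} → adj G x y ≡ true → x ≢ y
      adj⇒≢ {x} xx refl with trans (sym xx) (Graph.irrefl G x)
      ... | ()

      neq⇒≢ : ∀ {x y : Fin n} → neq x y ≡ true → x ≢ y
      neq⇒≢ {x} x≠x refl with x Fin.≟ x | x≠x
      ... | no x≢x | _ = x≢x refl

      V₁V₂⇒≢ : ∀ {x y} → V₁ x ≡ true → V₂ y ≡ true → x ≢ y
      V₁V₂⇒≢ x₁ y₂ refl rewrite x₁ with y₂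
      ... | ()

    type₁-path : ∀ {a b c d} → adj G a b ≡ true → adj G b c ≡ true → adj G c d ≡ true → a ≢ c →
      V₁ a ≡ true → V₁ b ≡ true → V₁ c ≡ true → V₂ d ≡ true → P₁ a b c d ≡ true
    type₁-path ab bc cd a≢c a₁ b₁ c₁ d₂ =
      (neq-true (adj⇒≢ ab) & neq-true a≢c & neq-true (V₁V₂⇒≢ a₁ d₂) & neq-true (adj⇒≢ bc)
        & neq-true (V₁V₂⇒≢ b₁ d₂) & neq-true (V₁V₂⇒≢ c₁ d₂) & ab & bc & cd)
      & a₁ & b₁ & c₁ & d₂

    type₂-path : ∀ {a b c d} → adj G a b ≡ true → adj G b c ≡ true → adj G c d ≡ true → a ≢ d →
      V₁ a ≡ true → V₂ b ≡ true → V₂ c ≡ true → V₁ d ≡ true → P₂ a b c d ≡ true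
    type₂-path ab bc cd a≢d a₁ b₂ c₂ d₁ =
      (neq-true (V₁V₂⇒≢ a₁ b₂) & neq-true (V₁V₂⇒≢ a₁ c₂) & neq-true a≢d & neq-true (adj⇒≢ bc)
        & neq-true (≢-sym (V₁V₂⇒≢ d₁ b₂)) & neq-true (≢-sym (V₁V₂⇒≢ d₁ c₂)) & ab & bc & cd)
      & a₁ & b₂ & c₂ & d₁

    deg₁ deg₂ : Fin n → ℕ
    deg₁ v = ∑[ u < n ] χ (adj G v u ∧ V₁ u)
    deg₂ v = ∑[ u < n ] χ (adj G v u ∧ V₂ u)

    module DegreeClasses (T : ℕ) where

      -- many₁ is strict so that T neighbours in V₁ remain after one vertex is excluded.
      many₁ many₂ : Fin n → Bool
      many₁ v = ⌊ T <? deg₁ v ⌋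
      many₂ v = ⌊ T ≤? deg₂ v ⌋

      H₁ L₁ R₁ H₂ L₂ : Fin n → Bool
      H₁ v = V₁ v ∧ many₂ v
      L₁ v = V₁ v ∧ not (many₂ v)
      R₁ v = V₁ v ∧ many₁ v
      H₂ v = V₂ v ∧ many₁ v
      L₂ v = V₂ v ∧ not (many₁ v)

      #_ : (Fin n → Bool) → ℕ
      # P = ∑[ v < n ] χ (P v)

      x₁ x₂ : ℕ
      x₁ = pairs (λ b c → R₁ b ∧ H₁ c ∧ adj G b c)
      x₂ = pairs (λ b c → H₂ b ∧ H₂ c ∧ adj G b c)

      private
        split : ∀ (P Q : Fin n → Bool) → # P ≡ # (λ v → P v ∧ not (Q v)) + # (λ v → P v ∧ Q v)
        split P Q = trans (sum-cong-≗ λ v → cases (P v) (Q v))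
          (∑-distrib-+ (λ v → χ (P v ∧ not (Q v))) (λ v → χ (P v ∧ Q v)))
          where
          cases : ∀ p q → χ p ≡ χ (p ∧ not q) + χ (p ∧ q)
          cases false _     = refl
          cases true  false = refl
          cases true  true  = refl

        few₁ : ∀ v → not (many₁ v) ≡ true → deg₁ v ≤ T
        few₁ v _ with T <? deg₁ v
        ... | no T≮deg = ≮⇒≥ T≮deg

        few₂ : ∀ v → not (many₂ v) ≡ true → deg₂ v ≤ T
        few₂ v _ with T ≤? deg₂ v
        ... | no T≰deg = <⇒≤ (≰⇒> T≰deg)

      #V₁≡#L₁+#H₁ : # V₁ ≡ # L₁ + # H₁
      #V₁≡#L₁+#H₁ = split V₁ many₂

      #V₂≡#L₂+#H₂ : # V₂ ≡ # L₂ + # H₂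
      #V₂≡#L₂+#H₂ = split V₂ many₁

      private
        low₁ low₂ low₃ : Fin n → Fin n → ℕ
        low₁ v u = χ (not (many₁ v)) * χ (adj G v u ∧ V₁ u)
        low₂ v u = χ (L₁ v) * χ (adj G v u ∧ V₂ u)
        low₃ v u = χ (L₂ v) * χ (adj G v u ∧ V₁ u)

        ∑∑low₁≤ : ∑∑ low₁ ≤ n * T
        ∑∑low₁≤ = ∑∑-rows-≤ (not ∘ many₁) (λ v u → adj G v u ∧ V₁ u) few₁

        ∑∑low₂≤ : ∑∑ low₂ ≤ n * T
        ∑∑low₂≤ = ∑∑-rows-≤ L₁ (λ v u → adj G v u ∧ V₂ u) (λ v L₁v → few₂ v (∧-conicalʳ (V₁ v) _ L₁v))

        ∑∑low₃≤ : ∑∑ low₃ ≤ n * T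
        ∑∑low₃≤ = ∑∑-rows-≤ L₂ (λ v u → adj G v u ∧ V₁ u) (λ v L₂v → few₁ v (∧-conicalʳ (V₂ v) _ L₂v))

        r₁h₁ h₂h₂ : Fin n → Fin n → ℕ
        r₁h₁ b c = χ (R₁ b ∧ H₁ c ∧ adj G b c)
        h₂h₂ b c = χ (H₂ b ∧ H₂ c ∧ adj G b c)

        _⊗_ : (Fin n → Bool) → (Fin n → Bool) → Fin n → Fin n → ℕ
        (P ⊗ Q) i j = χ (P i) * χ (Q j)

        ∑∑-⊗ : ∀ P Q → ∑∑ (P ⊗ Q) ≡ # P * # Q
        ∑∑-⊗ P Q = ∑∑-product (χ ∘ P) (χ ∘ Q)

        -- An edge of G[V₁] has an endpoint with at most T neighbours in V₁, joins R₁ to H₁, or lies in L₁.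
        cases₁₁ : ∀ a a′ → a ≡ a′ → ∀ p q x y s t →
          χ (a ∧ p ∧ q) ≤ (χ (not x) * χ (a ∧ q) + χ (not y) * χ (a′ ∧ p))
                          + (χ ((p ∧ x) ∧ (q ∧ t) ∧ a) + χ ((q ∧ y) ∧ (p ∧ s) ∧ a′))
                          + χ (p ∧ not s) * χ (q ∧ not t)
        cases₁₁ false _ refl _     _     _     _     _     _     = z≤n
        cases₁₁ true  _ refl false _     _     _     _     _     = z≤n
        cases₁₁ true  _ refl true  false _     _     _     _     = z≤n
        cases₁₁ true  _ refl true  true  false _     _     _     = s≤s z≤n
        cases₁₁ true  _ refl true  true  true  false _     _     = s≤s z≤n
        cases₁₁ true  _ refl true  true  true  true  _     true  = s≤s z≤n
        cases₁₁ true  _ refl true  true  true  true  true  false = s≤s z≤n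
        cases₁₁ true  _ refl true  true  true  true  false false = s≤s z≤n

        -- An edge of G[V₁,V₂] has an endpoint in L₁ or L₂, or joins H₁ to H₂.
        cases₁₂ : ∀ a a′ → a ≡ a′ → ∀ p q s y →
          χ (a ∧ p ∧ not q) ≤ χ (p ∧ not s) * χ (a ∧ not q) + χ (not q ∧ not y) * χ (a′ ∧ p)
                              + χ (p ∧ s) * χ (not q ∧ y)
        cases₁₂ false _ refl _     _     _     _     = z≤n
        cases₁₂ true  _ refl false _     _     _     = z≤n
        cases₁₂ true  _ refl true  true  _     _     = z≤n
        cases₁₂ true  _ refl true  false false _     = s≤s z≤n
        cases₁₂ true  _ refl true  false true  false = s≤s z≤n
        cases₁₂ true  _ refl true  false true  true  = s≤s z≤n

        -- An edge of G[V₂] has an endpoint in L₂ or lies in H₂.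
        cases₂₂ : ∀ a p q x y →
          χ (a ∧ not p ∧ not q) ≤ χ (not p ∧ not x) * χ (not q) + χ (not p ∧ x) * χ (not q ∧ not y)
                                  + χ ((not p ∧ x) ∧ (not q ∧ y) ∧ a)
        cases₂₂ false _     _     _     _     = z≤n
        cases₂₂ true  true  _     _     _     = z≤n
        cases₂₂ true  false true  _     _     = z≤n
        cases₂₂ true  false false false _     = s≤s z≤n
        cases₂₂ true  false false true  false = s≤s z≤n
        cases₂₂ true  false false true  true  = s≤s z≤n

      e₁₁≤ : e₁₁ ≤ # L₁ * # L₁ + 2 * (x₁ + n * T)
      e₁₁≤ = begin
        e₁₁
          ≤⟨ ∑∑-mono-≤ (λ b c → cases₁₁ (adj G b c) (adj G c b) (Graph.sym G b c)
                                        (V₁ b) (V₁ c) (many₁ b) (many₁ c) (many₂ b) (many₂ c)) ⟩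
        ∑∑ (low₁ +ᶠ low₁ ᵀ +ᶠ (r₁h₁ +ᶠ r₁h₁ ᵀ) +ᶠ L₁ ⊗ L₁)
          ≡⟨ ∑∑-distrib-+₃ (low₁ +ᶠ low₁ ᵀ) (r₁h₁ +ᶠ r₁h₁ ᵀ) (L₁ ⊗ L₁) ⟩
        ∑∑ (low₁ +ᶠ low₁ ᵀ) + ∑∑ (r₁h₁ +ᶠ r₁h₁ ᵀ) + ∑∑ (L₁ ⊗ L₁)
          ≡⟨ cong₂ _+_ (cong₂ _+_ (∑∑-symmetrize low₁) (∑∑-symmetrize r₁h₁)) (∑∑-⊗ L₁ L₁) ⟩
        2 * ∑∑ low₁ + 2 * x₁ + # L₁ * # L₁
          ≤⟨ +-monoˡ-≤ (# L₁ * # L₁) (+-monoˡ-≤ (2 * x₁) (*-monoʳ-≤ 2 ∑∑low₁≤)) ⟩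
        2 * (n * T) + 2 * x₁ + # L₁ * # L₁
          ≡⟨ solve 3 (λ z x l → con 2 :* z :+ con 2 :* x :+ l := l :+ con 2 :* (x :+ z)) refl (n * T) x₁ (# L₁ * # L₁) ⟩
        # L₁ * # L₁ + 2 * (x₁ + n * T) ∎
        where open ℕ.≤-Reasoning

      e₁₂≤ : e₁₂ ≤ # H₁ * # H₂ + 2 * (n * T)
      e₁₂≤ = begin
        e₁₂
          ≤⟨ ∑∑-mono-≤ (λ i j → cases₁₂ (adj G i j) (adj G j i) (Graph.sym G i j) (V₁ i) (V₁ j) (many₂ i) (many₁ j)) ⟩
        ∑∑ (low₂ +ᶠ low₃ ᵀ +ᶠ H₁ ⊗ H₂)
          ≡⟨ ∑∑-distrib-+₃ low₂ (low₃ ᵀ) (H₁ ⊗ H₂) ⟩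
        ∑∑ low₂ + ∑∑ (low₃ ᵀ) + ∑∑ (H₁ ⊗ H₂)
          ≤⟨ +-mono-≤ (+-mono-≤ ∑∑low₂≤ (≤-trans (≤-reflexive (∑∑-transpose low₃)) ∑∑low₃≤)) (≤-reflexive (∑∑-⊗ H₁ H₂)) ⟩
        n * T + n * T + # H₁ * # H₂
          ≡⟨ solve 2 (λ z h → z :+ z :+ h := h :+ con 2 :* z) refl (n * T) (# H₁ * # H₂) ⟩
        # H₁ * # H₂ + 2 * (n * T) ∎
        where open ℕ.≤-Reasoning

      e₂₂≤ : e₂₂ ≤ # L₂ * # V₂ + # H₂ * # L₂ + x₂
      e₂₂≤ = begin
        e₂₂
          ≤⟨ ∑∑-mono-≤ (λ b c → cases₂₂ (adj G b c) (V₁ b) (V₁ c) (many₁ b) (many₁ c)) ⟩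
        ∑∑ (L₂ ⊗ V₂ +ᶠ H₂ ⊗ L₂ +ᶠ h₂h₂)
          ≡⟨ ∑∑-distrib-+₃ (L₂ ⊗ V₂) (H₂ ⊗ L₂) h₂h₂ ⟩
        ∑∑ (L₂ ⊗ V₂) + ∑∑ (H₂ ⊗ L₂) + x₂
          ≡⟨ cong (_+ x₂) (cong₂ _+_ (∑∑-⊗ L₂ V₂) (∑∑-⊗ H₂ L₂)) ⟩
        # L₂ * # V₂ + # H₂ * # L₂ + x₂ ∎
        where open ℕ.≤-Reasoning

      private
        many₁⇒ : ∀ {v} → many₁ v ≡ true → T < deg₁ v
        many₁⇒ {v} _ with T <? deg₁ v
        ... | yes T<deg = T<deg

        many₂⇒ : ∀ {v} → many₂ v ≡ true → T ≤ deg₂ v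
        many₂⇒ {v} _ with T ≤? deg₂ v
        ... | yes T≤deg = T≤deg

        T≤deg-1 : ∀ (P : Fin n → Bool) (c : Fin n) → T < ∑[ a < n ] χ (P a) →
                  T ≤ ∑[ a < n ] χ (P a ∧ neq a c)
        T≤deg-1 P c T<∑ = ℕ.≤-pred (≤-trans T<∑ (≤-trans (∑-drop-one P c) (≤-reflexive (ℕ.+-comm _ 1))))

      paths₁-through : ∀ {b c} → R₁ b ≡ true → H₁ c ≡ true → adj G b c ≡ true →
        T * T ≤ ∑∑ (λ a d → χ (P₁ a b c d))
      paths₁-through {b} {c} R₁b H₁c bc = begin
        T * T
          ≤⟨ ℕ.*-mono-≤ (T≤deg-1 (λ a → adj G b a ∧ V₁ a) c (many₁⇒ (proj₂ (∧-true R₁b)))) (many₂⇒ (proj₂ (∧-true H₁c))) ⟩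
        ∑[ a < n ] χ ((adj G b a ∧ V₁ a) ∧ neq a c) * deg₂ c
          ≡⟨ ∑∑-product (λ a → χ ((adj G b a ∧ V₁ a) ∧ neq a c)) (λ d → χ (adj G c d ∧ V₂ d)) ⟨
        ∑∑ (λ a d → χ ((adj G b a ∧ V₁ a) ∧ neq a c) * χ (adj G c d ∧ V₂ d))
          ≤⟨ ∑∑-mono-≤ (λ a d → χ*χ≤χ (path a d)) ⟩
        ∑∑ (λ a d → χ (P₁ a b c d)) ∎
        where
        open ℕ.≤-Reasoning
        path : ∀ a d → (adj G b a ∧ V₁ a) ∧ neq a c ≡ true → adj G c d ∧ V₂ d ≡ true → P₁ a b c d ≡ true
        path a d N M =
          let (ba∧a₁ , a≢c) = ∧-true N ; (ba , a₁) = ∧-true ba∧a₁ ; (cd , d₂) = ∧-true M in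
          type₁-path (trans (Graph.sym G a b) ba) bc cd (neq⇒≢ a≢c) a₁ (proj₁ (∧-true R₁b)) (proj₁ (∧-true H₁c)) d₂

      paths₂-through : ∀ {b c} → H₂ b ≡ true → H₂ c ≡ true → adj G b c ≡ true →
        T * T ≤ ∑∑ (λ a d → χ (P₂ a b c d))
      paths₂-through {b} {c} H₂b H₂c bc = begin
        T * T
          ≤⟨ ℕ.*-monoˡ-≤ T (<⇒≤ (many₁⇒ (proj₂ (∧-true H₂b)))) ⟩
        deg₁ b * T
          ≡⟨ *-distribʳ-sum T (λ a → χ (adj G b a ∧ V₁ a)) ⟩
        ∑[ a < n ] (χ (adj G b a ∧ V₁ a) * T)
          ≤⟨ ∑-mono-≤ (λ a → *-monoʳ-≤ (χ (adj G b a ∧ V₁ a))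
                        (T≤deg-1 (λ d → adj G c d ∧ V₁ d) a (many₁⇒ (proj₂ (∧-true H₂c))))) ⟩
        ∑[ a < n ] (χ (adj G b a ∧ V₁ a) * ∑[ d < n ] χ ((adj G c d ∧ V₁ d) ∧ neq d a))
          ≡⟨ sum-cong-≗ (λ a → *-distribˡ-sum (χ (adj G b a ∧ V₁ a)) (λ d → χ ((adj G c d ∧ V₁ d) ∧ neq d a))) ⟩
        ∑∑ (λ a d → χ (adj G b a ∧ V₁ a) * χ ((adj G c d ∧ V₁ d) ∧ neq d a))
          ≤⟨ ∑∑-mono-≤ (λ a d → χ*χ≤χ (path a d)) ⟩
        ∑∑ (λ a d → χ (P₂ a b c d)) ∎
        where
        open ℕ.≤-Reasoning
        path : ∀ a d → adj G b a ∧ V₁ a ≡ true → (adj G c d ∧ V₁ d) ∧ neq d a ≡ true → P₂ a b c d ≡ true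
        path a d N M =
          let (ba , a₁) = ∧-true N ; (cd∧d₁ , d≢a) = ∧-true M ; (cd , d₁) = ∧-true cd∧d₁ in
          type₂-path (trans (Graph.sym G a b) ba) bc cd (≢-sym (neq⇒≢ d≢a)) a₁ (proj₁ (∧-true H₂b)) (proj₁ (∧-true H₂c)) d₁

      private
        paths≡∑⁴ : ∀ P → countFin⁴ n P ≡ ∑⁴ (λ a b c d → χ (P a b c d))
        paths≡∑⁴ P = trans (list-sum≡∑ n _) (sum-cong-≗ λ a → trans (list-sum≡∑ n _)
          (sum-cong-≗ λ b → trans (list-sum≡∑ n _) (sum-cong-≗ λ c → countFin≡∑ n (P a b c))))

      x₁T²≤paths₁ : x₁ * (T * T) ≤ paths₁ G V₁
      x₁T²≤paths₁ = begin
        x₁ * (T * T)                                        ≡⟨ ∑∑-*ʳ r₁h₁ (T * T) ⟩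
        ∑∑ (λ b c → χ (R₁ b ∧ H₁ c ∧ adj G b c) * (T * T))   ≤⟨ ∑∑-mono-≤ through ⟩
        ∑∑ (λ b c → ∑∑ (λ a d → χ (P₁ a b c d)))            ≡⟨ ∑⁴-middle-first (λ a b c d → χ (P₁ a b c d)) ⟨
        ∑⁴ (λ a b c d → χ (P₁ a b c d))                     ≡⟨ paths≡∑⁴ P₁ ⟨
        paths₁ G V₁                                          ∎
        where
        open ℕ.≤-Reasoning
        through : ∀ b c → χ (R₁ b ∧ H₁ c ∧ adj G b c) * (T * T) ≤ ∑∑ (λ a d → χ (P₁ a b c d))
        through b c with R₁ b ∧ H₁ c ∧ adj G b c in R₁b∧H₁c∧bc
        ... | false = z≤n
        ... | true  = let (R₁b , H₁c∧bc) = ∧-true R₁b∧H₁c∧bc ; (H₁c , bc) = ∧-true H₁c∧bc in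
                      ≤-trans (≤-reflexive (ℕ.*-identityˡ (T * T))) (paths₁-through R₁b H₁c bc)

      x₂T²≤paths₂ : x₂ * (T * T) ≤ paths₂ G V₁
      x₂T²≤paths₂ = begin
        x₂ * (T * T)                                        ≡⟨ ∑∑-*ʳ h₂h₂ (T * T) ⟩
        ∑∑ (λ b c → χ (H₂ b ∧ H₂ c ∧ adj G b c) * (T * T))   ≤⟨ ∑∑-mono-≤ through ⟩
        ∑∑ (λ b c → ∑∑ (λ a d → χ (P₂ a b c d)))            ≡⟨ ∑⁴-middle-first (λ a b c d → χ (P₂ a b c d)) ⟨
        ∑⁴ (λ a b c d → χ (P₂ a b c d))                     ≡⟨ paths≡∑⁴ P₂ ⟨
        paths₂ G V₁                                          ∎
        where
        open ℕ.≤-Reasoning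
        through : ∀ b c → χ (H₂ b ∧ H₂ c ∧ adj G b c) * (T * T) ≤ ∑∑ (λ a d → χ (P₂ a b c d))
        through b c with H₂ b ∧ H₂ c ∧ adj G b c in H₂b∧H₂c∧bc
        ... | false = z≤n
        ... | true  = let (H₂b , H₂c∧bc) = ∧-true H₂b∧H₂c∧bc ; (H₂c , bc) = ∧-true H₂c∧bc in
                      ≤-trans (≤-reflexive (ℕ.*-identityˡ (T * T))) (paths₂-through H₂b H₂c bc)

module RationalInequalities where

  open import Data.Integer.Base using (+_)
  import Data.Integer.Base as ℤ
  import Data.Integer.Properties as ℤ
  open import Data.Nat.Base as ℕ using (ℕ)
  import Data.Nat.Properties as ℕ
  import Data.Nat.Coprimality as C
  open import Data.Rational.Literals using (fromℤ)
  open import Data.Rational.Base using (ℚ; 0ℚ; 1ℚ; _+_; _-_; _*_; -_; 1/_; _≤_; _<_; _/_; *≤*; positive; nonNegative; nonPositive)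
  open import Data.Rational.Properties
  open import Data.Rational.Solver using (module +-*-Solver)
  open import Data.Sum using (inj₁; inj₂)
  open import Relation.Binary.PropositionalEquality
  open import Relation.Nullary using (¬_)
  open +-*-Solver

  p≤q⇒0≤q-p : ∀ {p q} → p ≤ q → 0ℚ ≤ q - p
  p≤q⇒0≤q-p {p} {q} p≤q = subst (_≤ q - p) (+-inverseʳ p) (+-monoˡ-≤ (- p) p≤q)

  p≤q⇒p-q≤0 : ∀ {p q} → p ≤ q → p - q ≤ 0ℚ
  p≤q⇒p-q≤0 {p} {q} p≤q = subst (p - q ≤_) (+-inverseʳ q) (+-monoˡ-≤ (- q) p≤q)

  0≤q-p⇒p≤q : ∀ {p q} → 0ℚ ≤ q - p → p ≤ q
  0≤q-p⇒p≤q {p} {q} 0≤q-p = subst₂ _≤_ (+-identityˡ p) q-p+p≡q (+-monoˡ-≤ p 0≤q-p)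
    where
    q-p+p≡q : q - p + p ≡ q
    q-p+p≡q = solve 2 (λ p q → q :- p :+ p := q) refl p q

  ≤-by-gap : ∀ {p q} d → q - p ≡ d → 0ℚ ≤ d → p ≤ q
  ≤-by-gap d q-p≡d 0≤d = 0≤q-p⇒p≤q (subst (0ℚ ≤_) (sym q-p≡d) 0≤d)

  infixl 6 _⊞_
  infixl 7 _⊠_

  _⊞_ : ∀ {p q} → 0ℚ ≤ p → 0ℚ ≤ q → 0ℚ ≤ p + q
  _⊞_ = +-mono-≤

  _⊠_ : ∀ {p q} → 0ℚ ≤ p → 0ℚ ≤ q → 0ℚ ≤ p * q
  _⊠_ {p} {q} 0≤p 0≤q = subst (_≤ p * q) (*-zeroˡ q) (*-monoʳ-≤-nonNeg q {{nonNegative 0≤q}} 0≤p)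

  0≤p*p : ∀ p → 0ℚ ≤ p * p
  0≤p*p p with ≤-total 0ℚ p
  ... | inj₁ 0≤p = 0≤p ⊠ 0≤p
  ... | inj₂ p≤0 = subst (_≤ p * p) (*-zeroˡ p) (*-monoʳ-≤-nonPos p {{nonPositive p≤0}} p≤0)

  0≤n/d : ∀ n d .{{_ : ℕ.NonZero d}} → 0ℚ ≤ + n / d
  0≤n/d n d = nonNegative⁻¹ (+ n / d) {{normalize-nonNeg n d}}

  *-pres-0< : ∀ {p q} → 0ℚ < p → 0ℚ < q → 0ℚ < p * q
  *-pres-0< {p} {q} 0<p 0<q = subst (_< p * q) (*-zeroˡ q) (*-monoˡ-<-pos q {{positive 0<q}} 0<p)

  <⇒≱ : ∀ {p q} → p < q → ¬ (q ≤ p)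
  <⇒≱ p<q q≤p = <-irrefl refl (<-≤-trans p<q q≤p)

  p≤p+q : ∀ {p q} → 0ℚ ≤ q → p ≤ p + q
  p≤p+q {p} {q} 0≤q = subst (_≤ p + q) (+-identityʳ p) (+-monoʳ-≤ p 0≤q)

  q≤p+q : ∀ {p q} → 0ℚ ≤ p → q ≤ p + q
  q≤p+q {p} {q} 0≤p = subst (_≤ p + q) (+-identityˡ q) (+-monoˡ-≤ q 0≤p)

  *-monoˡ-≤-0≤ : ∀ {r p q} → 0ℚ ≤ r → p ≤ q → r * p ≤ r * q
  *-monoˡ-≤-0≤ {r} 0≤r = *-monoˡ-≤-nonNeg r {{nonNegative 0≤r}}

  *-monoʳ-≤-0≤ : ∀ {r p q} → 0ℚ ≤ r → p ≤ q → p * r ≤ q * r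
  *-monoʳ-≤-0≤ {r} 0≤r = *-monoʳ-≤-nonNeg r {{nonNegative 0≤r}}

  *-mono-≤-0≤ : ∀ {p q r s} → 0ℚ ≤ p → 0ℚ ≤ s → p ≤ q → r ≤ s → p * r ≤ q * s
  *-mono-≤-0≤ 0≤p 0≤s p≤q r≤s = ≤-trans (*-monoˡ-≤-0≤ 0≤p r≤s) (*-monoʳ-≤-0≤ 0≤s p≤q)

  *-cancelˡ-≤-0< : ∀ {r p q} → 0ℚ < r → r * p ≤ r * q → p ≤ q
  *-cancelˡ-≤-0< {r} 0<r = *-cancelˡ-≤-pos r {{positive 0<r}}

  square-mono-≤ : ∀ {p q} → 0ℚ ≤ p → p ≤ q → p * p ≤ q * q
  square-mono-≤ 0≤p p≤q = *-mono-≤-0≤ 0≤p (≤-trans 0≤p p≤q) p≤q p≤q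

  square-cancel-≤ : ∀ {p q} → 0ℚ ≤ q → p * p ≤ q * q → p ≤ q
  square-cancel-≤ {p} {q} 0≤q p²≤q² = ≮⇒≥ λ q<p → <⇒≱ (q²<p² q<p) p²≤q²
    where
    q²<p² : q < p → q * q < p * p
    q²<p² q<p = ≤-<-trans (*-monoˡ-≤-0≤ 0≤q (<⇒≤ q<p)) (*-monoˡ-<-pos p {{positive (≤-<-trans 0≤q q<p)}} q<p)

  ℕ→ℚ : ℕ → ℚ
  ℕ→ℚ k = + k / 1

  private
    ℕ→ℚ≡fromℤ : ∀ k → ℕ→ℚ k ≡ fromℤ (+ k)
    ℕ→ℚ≡fromℤ k = normalize-coprime (C.sym (C.1-coprimeTo k))

  ℕ→ℚ-+ : ∀ j k → ℕ→ℚ (j ℕ.+ k) ≡ ℕ→ℚ j + ℕ→ℚ k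
  ℕ→ℚ-+ j k = begin
    + (j ℕ.+ k) / 1             ≡⟨ /-cong (trans (ℤ.pos-+ j k) (cong₂ ℤ._+_ (sym (ℤ.*-identityʳ (+ j))) (sym (ℤ.*-identityʳ (+ k))))) refl ⟩
    fromℤ (+ j) + fromℤ (+ k)   ≡⟨ cong₂ _+_ (ℕ→ℚ≡fromℤ j) (ℕ→ℚ≡fromℤ k) ⟨
    ℕ→ℚ j + ℕ→ℚ k               ∎
    where open ≡-Reasoning

  ℕ→ℚ-* : ∀ j k → ℕ→ℚ (j ℕ.* k) ≡ ℕ→ℚ j * ℕ→ℚ k
  ℕ→ℚ-* j k = begin
    + (j ℕ.* k) / 1             ≡⟨ /-cong (ℤ.pos-* j k) refl ⟩
    fromℤ (+ j) * fromℤ (+ k)   ≡⟨ cong₂ _*_ (ℕ→ℚ≡fromℤ j) (ℕ→ℚ≡fromℤ k) ⟨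
    ℕ→ℚ j * ℕ→ℚ k               ∎
    where open ≡-Reasoning

  ℕ→ℚ-^2 : ∀ j → ℕ→ℚ (j ℕ.^ 2) ≡ ℕ→ℚ j * ℕ→ℚ j
  ℕ→ℚ-^2 j = trans (cong (λ i → ℕ→ℚ (j ℕ.* i)) (ℕ.*-identityʳ j)) (ℕ→ℚ-* j j)

  ℕ→ℚ-^4 : ∀ j → ℕ→ℚ (j ℕ.^ 4) ≡ ℕ→ℚ j * (ℕ→ℚ j * (ℕ→ℚ j * ℕ→ℚ j))
  ℕ→ℚ-^4 j = begin
    ℕ→ℚ (j ℕ.* (j ℕ.* (j ℕ.* (j ℕ.* 1))))   ≡⟨ cong (λ i → ℕ→ℚ (j ℕ.* (j ℕ.* (j ℕ.* i)))) (ℕ.*-identityʳ j) ⟩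
    ℕ→ℚ (j ℕ.* (j ℕ.* (j ℕ.* j)))          ≡⟨ ℕ→ℚ-* j (j ℕ.* (j ℕ.* j)) ⟩
    ℕ→ℚ j * ℕ→ℚ (j ℕ.* (j ℕ.* j))          ≡⟨ cong (ℕ→ℚ j *_) (trans (ℕ→ℚ-* j (j ℕ.* j)) (cong (ℕ→ℚ j *_) (ℕ→ℚ-* j j))) ⟩
    ℕ→ℚ j * (ℕ→ℚ j * (ℕ→ℚ j * ℕ→ℚ j))     ∎
    where open ≡-Reasoning

  ℕ→ℚ-mono-≤ : ∀ {j k} → j ℕ.≤ k → ℕ→ℚ j ≤ ℕ→ℚ k
  ℕ→ℚ-mono-≤ {j} {k} j≤k rewrite ℕ→ℚ≡fromℤ j | ℕ→ℚ≡fromℤ k =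
    *≤* (subst₂ ℤ._≤_ (sym (ℤ.*-identityʳ (+ j))) (sym (ℤ.*-identityʳ (+ k))) (ℤ.+≤+ j≤k))

  0≤ℕ→ℚ : ∀ k → 0ℚ ≤ ℕ→ℚ k
  0≤ℕ→ℚ k = ℕ→ℚ-mono-≤ {0} {k} ℕ.z≤n

  1/ℕ : (m : ℕ) .{{_ : ℕ.NonZero m}} → ℚ
  1/ℕ m = 1/ fromℤ (+ m)

  1/ℕ-inverse : ∀ m .{{_ : ℕ.NonZero m}} → 1/ℕ m * ℕ→ℚ m ≡ 1ℚ
  1/ℕ-inverse m = trans (cong (1/ℕ m *_) (ℕ→ℚ≡fromℤ m)) (*-inverseˡ (fromℤ (+ m)))

module Sqrt3Order where

  open import Data.Integer.Base using (+_)
  import Data.Integer.Base as ℤ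
  open import Data.Rational.Base using (ℚ; 0ℚ; ½; -½; _+_; _-_; _*_; -_; _≤_; _/_)
  open import Data.Rational.Properties
  open import Data.Rational.Solver using (module +-*-Solver)
  open import Data.Product using (_,_)
  open import Data.Sum using (inj₁; inj₂)
  open import Data.Empty using (⊥-elim)
  open import Relation.Binary.PropositionalEquality
  open import Relation.Nullary using (yes; no)
  open import Defs using (ℚ√3; _+_√3; re; im; NonNeg; _≼_; _⊕_; _⊖_; _⊗_; ι; α; α/2; γ)
  open RationalInequalities
  open +-*-Solver

  record LowerSqrt3 (u : ℚ) : Set where
    field
      nonNeg : 0ℚ ≤ u
      sq≤3   : u * u ≤ + 3 / 1

  record UpperSqrt3 (v : ℚ) : Set where
    field
      nonNeg : 0ℚ ≤ v
      3≤sq   : + 3 / 1 ≤ v * v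

  infixl 8 _at_

  _at_ : ℚ√3 → ℚ → ℚ
  x at u = re x + im x * u

  private
    neg-square : ∀ p → - p * - p ≡ p * p
    neg-square = solve 1 (λ p → :- p :* :- p := p :* p) refl

    0≤p+q⇐-p≤q : ∀ {p q} → - p ≤ q → 0ℚ ≤ p + q
    0≤p+q⇐-p≤q {p} {q} -p≤q = subst (0ℚ ≤_) (solve 2 (λ p q → q :- :- p := p :+ q) refl p q) (p≤q⇒0≤q-p -p≤q)

  nonNeg⇒0≤at-upper : ∀ {v} → UpperSqrt3 v → ∀ x → NonNeg x → 0ℚ ≤ im x → 0ℚ ≤ x at v
  nonNeg⇒0≤at-upper record { nonNeg = 0≤v } (a + b √3) (inj₁ (0≤a , _)) 0≤b = 0≤a ⊞ 0≤b ⊠ 0≤v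
  nonNeg⇒0≤at-upper _ (a + b √3) (inj₂ (inj₁ (_ , b<0 , _))) 0≤b = ⊥-elim (<⇒≱ b<0 0≤b)
  nonNeg⇒0≤at-upper {v} record { nonNeg = 0≤v ; 3≤sq = 3≤v² } (a + b √3) (inj₂ (inj₂ (_ , _ , a²≤3b²))) 0≤b =
    0≤p+q⇐-p≤q {a} {b * v} (square-cancel-≤ (0≤b ⊠ 0≤v) (begin
      - a * - a         ≡⟨ neg-square a ⟩
      a * a             ≤⟨ a²≤3b² ⟩
      + 3 / 1 * (b * b) ≤⟨ *-monoʳ-≤-0≤ (0≤p*p b) 3≤v² ⟩
      v * v * (b * b)   ≡⟨ solve 2 (λ b v → v :* v :* (b :* b) := b :* v :* (b :* v)) refl b v ⟩
      b * v * (b * v)   ∎))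
    where open ≤-Reasoning

  nonNeg⇒0≤at-lower : ∀ {u} → LowerSqrt3 u → ∀ x → NonNeg x → im x ≤ 0ℚ → 0ℚ ≤ x at u
  nonNeg⇒0≤at-lower {u} _ (a + b √3) (inj₁ (0≤a , 0≤b)) b≤0 with ≤-antisym b≤0 0≤b
  ... | refl = subst (0ℚ ≤_) (sym (trans (cong (λ w → a + w) (*-zeroˡ u)) (+-identityʳ a))) 0≤a
  nonNeg⇒0≤at-lower {u} record { sq≤3 = u²≤3 } (a + b √3) (inj₂ (inj₁ (0≤a , _ , 3b²≤a²))) b≤0 =
    subst (0ℚ ≤_) (+-comm (b * u) a) (0≤p+q⇐-p≤q {b * u} {a} (square-cancel-≤ 0≤a (begin
      - (b * u) * - (b * u) ≡⟨ solve 2 (λ b u → :- (b :* u) :* :- (b :* u) := u :* u :* (b :* b)) refl b u ⟩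
      u * u * (b * b)       ≤⟨ *-monoʳ-≤-0≤ (0≤p*p b) u²≤3 ⟩
      + 3 / 1 * (b * b)     ≤⟨ 3b²≤a² ⟩
      a * a                 ∎)))
    where open ≤-Reasoning
  nonNeg⇒0≤at-lower _ (a + b √3) (inj₂ (inj₂ (a<0 , 0≤b , a²≤3b²))) b≤0 with ≤-antisym b≤0 0≤b
  ... | refl = ⊥-elim (<⇒≱ (neg-antimono-< a<0) -a≤0)
    where
    -a≤0 : - a ≤ 0ℚ
    -a≤0 = square-cancel-≤ ≤-refl (subst (_≤ 0ℚ) (sym (neg-square a)) a²≤3b²)

  at-lower⇒nonNeg : ∀ {u} → LowerSqrt3 u → ∀ x → 0ℚ ≤ im x → 0ℚ ≤ x at u → NonNeg x
  at-lower⇒nonNeg {u} record { nonNeg = 0≤u ; sq≤3 = u²≤3 } (a + b √3) 0≤b 0≤a+bu with 0ℚ ≤? a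
  ... | yes 0≤a = inj₁ (0≤a , 0≤b)
  ... | no 0≰a = inj₂ (inj₂ (≰⇒> 0≰a , 0≤b , (begin
    a * a               ≡⟨ neg-square a ⟨
    - a * - a           ≤⟨ *-mono-≤-0≤ 0≤-a 0≤bu -a≤bu -a≤bu ⟩
    b * u * (b * u)     ≡⟨ solve 2 (λ b u → b :* u :* (b :* u) := u :* u :* (b :* b)) refl b u ⟩
    u * u * (b * b)     ≤⟨ *-monoʳ-≤-0≤ (0≤p*p b) u²≤3 ⟩
    + 3 / 1 * (b * b)   ∎)))
    where
    open ≤-Reasoning
    0≤bu : 0ℚ ≤ b * u
    0≤bu = 0≤b ⊠ 0≤u
    -a≤bu : - a ≤ b * u
    -a≤bu = 0≤q-p⇒p≤q (subst (0ℚ ≤_) (solve 3 (λ a b u → a :+ b :* u := b :* u :- :- a) refl a b u) 0≤a+bu)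
    0≤-a : 0ℚ ≤ - a
    0≤-a = neg-antimono-≤ (<⇒≤ (≰⇒> 0≰a))

  at-⊖ : ∀ x y u → (x ⊖ y) at u ≡ x at u - y at u
  at-⊖ (a + b √3) (c + d √3) =
    solve 5 (λ a b c d u → a :- c :+ (b :- d) :* u := a :+ b :* u :- (c :+ d :* u)) refl a b c d

  at-⊕ : ∀ x y u → (x ⊕ y) at u ≡ x at u + y at u
  at-⊕ (a + b √3) (c + d √3) =
    solve 5 (λ a b c d u → a :+ c :+ (b :+ d) :* u := a :+ b :* u :+ (c :+ d :* u)) refl a b c d

  at-⊗ι : ∀ x q u → (x ⊗ ι q) at u ≡ x at u * q
  at-⊗ι (a + b √3) = solve 4 (λ a b q u →
    a :* q :+ con (+ 3 / 1) :* (b :* con 0ℚ) :+ (a :* con 0ℚ :+ b :* q) :* u := (a :+ b :* u) :* q) refl a b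

  at-ι⊗ : ∀ q x u → (ι q ⊗ x) at u ≡ q * x at u
  at-ι⊗ q (a + b √3) = solve 4 (λ q a b u →
    q :* a :+ con (+ 3 / 1) :* (con 0ℚ :* b) :+ (q :* b :+ con 0ℚ :* a) :* u := q :* (a :+ b :* u)) refl q a b

  at-ι : ∀ q u → ι q at u ≡ q
  at-ι = solve 2 (λ q u → q :+ con 0ℚ :* u := q) refl

  im-⊗ι : ∀ x q → im (x ⊗ ι q) ≡ im x * q
  im-⊗ι (a + b √3) = solve 3 (λ a b q → a :* con 0ℚ :+ b :* q := b :* q) refl a b

  im-ι⊗ : ∀ q x → im (ι q ⊗ x) ≡ q * im x
  im-ι⊗ q (a + b √3) = solve 3 (λ q a b → q :* b :+ con 0ℚ :* a := q :* b) refl q a b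

  ≼⇒at-upper-≤ : ∀ {v} → UpperSqrt3 v → ∀ x y → x ≼ y → im x ≤ im y → x at v ≤ y at v
  ≼⇒at-upper-≤ {v} v-upper x y x≼y imx≤imy = 0≤q-p⇒p≤q
    (subst (0ℚ ≤_) (at-⊖ y x v) (nonNeg⇒0≤at-upper v-upper (y ⊖ x) x≼y (p≤q⇒0≤q-p imx≤imy)))

  ≼⇒at-lower-≤ : ∀ {u} → LowerSqrt3 u → ∀ x y → x ≼ y → im y ≤ im x → x at u ≤ y at u
  ≼⇒at-lower-≤ {u} u-lower x y x≼y imy≤imx = 0≤q-p⇒p≤q
    (subst (0ℚ ≤_) (at-⊖ y x u) (nonNeg⇒0≤at-lower u-lower (y ⊖ x) x≼y (p≤q⇒p-q≤0 imy≤imx)))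

  at-lower-≤⇒≼ : ∀ {u} → LowerSqrt3 u → ∀ x y → im x ≤ im y → x at u ≤ y at u → x ≼ y
  at-lower-≤⇒≼ {u} u-lower x y imx≤imy xu≤yu = at-lower⇒nonNeg u-lower (y ⊖ x)
    (p≤q⇒0≤q-p imx≤imy) (subst (0ℚ ≤_) (sym (at-⊖ y x u)) (p≤q⇒0≤q-p xu≤yu))

  α/2-at : ∀ w → α/2 at w ≡ w - + 3 / 2
  α/2-at w = trans (at-⊗ι α ½ w)
    (solve 1 (λ w → (con ((ℤ.- (+ 3)) / 1) :+ con (+ 2 / 1) :* w) :* con ½ := w :- con (+ 3 / 2)) refl w)

  γ-at : ∀ w → γ at w ≡ (+ 3 / 1 - w) * ½
  γ-at = solve 1 (λ w → con (+ 3 / 2) :+ con ((ℤ.- (+ 1)) / 2) :* w := (con (+ 3 / 1) :- w) :* con ½) refl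

  im-ι⊗ι : ∀ p q → im (ι p ⊗ ι q) ≡ 0ℚ
  im-ι⊗ι p q = trans (im-ι⊗ p (ι q)) (*-zeroʳ p)

  at-ι⊗ι : ∀ p q u → (ι p ⊗ ι q) at u ≡ p * q
  at-ι⊗ι p q u = trans (at-ι⊗ p (ι q) u) (cong (p *_) (at-ι q u))

  module _ (δ N : ℚ) (0≤N : 0ℚ ≤ N) where

    ≼⇒2k≤ : ∀ {s} K → LowerSqrt3 s → ι K ⊖ γ ⊗ ι N ≼ ι δ ⊗ ι N →
            + 2 / 1 * K ≤ (+ 3 / 1 - (s - + 2 / 1 * δ)) * N
    ≼⇒2k≤ {s} K s-lower h = ≤-by-gap _
      (solve 4 (λ s K N δ → (con (+ 3 / 1) :- (s :- con (+ 2 / 1) :* δ)) :* N :- con (+ 2 / 1) :* K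
        := con (+ 2 / 1) :* (δ :* N :- (K :- (con (+ 3 / 1) :- s) :* con ½ :* N))) refl s K N δ)
      (0≤n/d 2 1 ⊠ p≤q⇒0≤q-p (begin
        K - (+ 3 / 1 - s) * ½ * N                  ≡⟨ cong (λ g → K - g * N) (γ-at s) ⟨
        K - γ at s * N                            ≡⟨ cong₂ _-_ (at-ι K s) (at-⊗ι γ N s) ⟨
        ι K at s - (γ ⊗ ι N) at s                 ≡⟨ at-⊖ (ι K) (γ ⊗ ι N) s ⟨
        (ι K ⊖ γ ⊗ ι N) at s                      ≤⟨ ≼⇒at-lower-≤ s-lower (ι K ⊖ γ ⊗ ι N) (ι δ ⊗ ι N) h im≤ ⟩
        (ι δ ⊗ ι N) at s                          ≡⟨ at-ι⊗ι δ N s ⟩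
        δ * N                                     ∎))
      where
      open ≤-Reasoning
      im≤ : im (ι δ ⊗ ι N) ≤ im (ι K ⊖ γ ⊗ ι N)
      im≤ = begin
        im (ι δ ⊗ ι N)         ≡⟨ im-ι⊗ι δ N ⟩
        0ℚ                     ≤⟨ 0≤n/d 1 2 ⊠ 0≤N ⟩
        ½ * N                  ≡⟨ solve 1 (λ N → con ½ :* N := con 0ℚ :- con -½ :* N) refl N ⟩
        0ℚ - -½ * N            ≡⟨ cong (λ g → 0ℚ - g) (im-⊗ι γ N) ⟨
        im (ι K ⊖ γ ⊗ ι N)     ∎

    ≼⇒≤2k : ∀ {t} K → UpperSqrt3 t → γ ⊗ ι N ⊖ ι K ≼ ι δ ⊗ ι N →
            (+ 3 / 1 - (t + + 2 / 1 * δ)) * N ≤ + 2 / 1 * K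
    ≼⇒≤2k {t} K t-upper h = ≤-by-gap _
      (solve 4 (λ t K N δ → con (+ 2 / 1) :* K :- (con (+ 3 / 1) :- (t :+ con (+ 2 / 1) :* δ)) :* N
        := con (+ 2 / 1) :* (δ :* N :- ((con (+ 3 / 1) :- t) :* con ½ :* N :- K))) refl t K N δ)
      (0≤n/d 2 1 ⊠ p≤q⇒0≤q-p (begin
        (+ 3 / 1 - t) * ½ * N - K                  ≡⟨ cong (λ g → g * N - K) (γ-at t) ⟨
        γ at t * N - K                             ≡⟨ cong₂ _-_ (at-⊗ι γ N t) (at-ι K t) ⟨
        (γ ⊗ ι N) at t - ι K at t                  ≡⟨ at-⊖ (γ ⊗ ι N) (ι K) t ⟨
        (γ ⊗ ι N ⊖ ι K) at t                       ≤⟨ ≼⇒at-upper-≤ t-upper (γ ⊗ ι N ⊖ ι K) (ι δ ⊗ ι N) h im≤ ⟩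
        (ι δ ⊗ ι N) at t                           ≡⟨ at-ι⊗ι δ N t ⟩
        δ * N                                      ∎))
      where
      open ≤-Reasoning
      im≤ : im (γ ⊗ ι N ⊖ ι K) ≤ im (ι δ ⊗ ι N)
      im≤ = begin
        im (γ ⊗ ι N ⊖ ι K)     ≡⟨ cong (λ g → g - 0ℚ) (im-⊗ι γ N) ⟩
        -½ * N - 0ℚ            ≡⟨ solve 1 (λ N → con -½ :* N :- con 0ℚ := :- (con ½ :* N)) refl N ⟩
        - (½ * N)              ≤⟨ neg-antimono-≤ (0≤n/d 1 2 ⊠ 0≤N) ⟩
        0ℚ                     ≡⟨ im-ι⊗ι δ N ⟨
        im (ι δ ⊗ ι N)         ∎

  module _ (δ Q E : ℚ) (0≤δ : 0ℚ ≤ δ) (0≤Q : 0ℚ ≤ Q) where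

    ≼⇒2e≤ : ∀ {t} → UpperSqrt3 t → ι E ≼ (α/2 ⊕ ι δ) ⊗ ι Q →
            + 2 / 1 * E ≤ (+ 2 / 1 * (t + + 2 / 1 * δ) - + 3 / 1) * Q
    ≼⇒2e≤ {t} t-upper h = ≤-by-gap _
      (solve 4 (λ t E Q δ → (con (+ 2 / 1) :* (t :+ con (+ 2 / 1) :* δ) :- con (+ 3 / 1)) :* Q :- con (+ 2 / 1) :* E
        := con (+ 2 / 1) :* ((t :- con (+ 3 / 2) :+ δ) :* Q :- E) :+ con (+ 2 / 1) :* δ :* Q) refl t E Q δ)
      (0≤n/d 2 1 ⊠ p≤q⇒0≤q-p (begin
        E                                          ≡⟨ at-ι E t ⟨
        ι E at t                                   ≤⟨ ≼⇒at-upper-≤ t-upper (ι E) ((α/2 ⊕ ι δ) ⊗ ι Q) h im≤ ⟩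
        ((α/2 ⊕ ι δ) ⊗ ι Q) at t                   ≡⟨ at-⊗ι (α/2 ⊕ ι δ) Q t ⟩
        (α/2 ⊕ ι δ) at t * Q                       ≡⟨ cong (_* Q) (trans (at-⊕ α/2 (ι δ) t) (cong₂ _+_ (α/2-at t) (at-ι δ t))) ⟩
        (t - + 3 / 2 + δ) * Q                      ∎) ⊞ 0≤n/d 2 1 ⊠ 0≤δ ⊠ 0≤Q)
      where
      open ≤-Reasoning
      im≤ : im (ι E) ≤ im ((α/2 ⊕ ι δ) ⊗ ι Q)
      im≤ = subst (0ℚ ≤_) (sym (im-⊗ι (α/2 ⊕ ι δ) Q)) (0≤n/d 1 1 ⊠ 0≤Q)

    ≼⇒≤2e : ∀ {s} → LowerSqrt3 s → (α/2 ⊖ ι δ) ⊗ ι Q ≼ ι E →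
            (+ 2 / 1 * (s - + 2 / 1 * δ) - + 3 / 1) * Q ≤ + 2 / 1 * E
    ≼⇒≤2e {s} s-lower h = ≤-by-gap _
      (solve 4 (λ s E Q δ → con (+ 2 / 1) :* E :- (con (+ 2 / 1) :* (s :- con (+ 2 / 1) :* δ) :- con (+ 3 / 1)) :* Q
        := con (+ 2 / 1) :* (E :- (s :- con (+ 3 / 2) :- δ) :* Q) :+ con (+ 2 / 1) :* δ :* Q) refl s E Q δ)
      (0≤n/d 2 1 ⊠ p≤q⇒0≤q-p (begin
        (s - + 3 / 2 - δ) * Q                      ≡⟨ cong (_* Q) (trans (at-⊖ α/2 (ι δ) s) (cong₂ _-_ (α/2-at s) (at-ι δ s))) ⟨
        (α/2 ⊖ ι δ) at s * Q                       ≡⟨ at-⊗ι (α/2 ⊖ ι δ) Q s ⟨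
        ((α/2 ⊖ ι δ) ⊗ ι Q) at s                   ≤⟨ ≼⇒at-lower-≤ s-lower ((α/2 ⊖ ι δ) ⊗ ι Q) (ι E) h im≤ ⟩
        ι E at s                                   ≡⟨ at-ι E s ⟩
        E                                          ∎) ⊞ 0≤n/d 2 1 ⊠ 0≤δ ⊠ 0≤Q)
      where
      open ≤-Reasoning
      im≤ : im (ι E) ≤ im ((α/2 ⊖ ι δ) ⊗ ι Q)
      im≤ = subst (0ℚ ≤_) (sym (im-⊗ι (α/2 ⊖ ι δ) Q)) (0≤n/d 1 1 ⊠ 0≤Q)

  2e≤⇒≼ : ∀ {u} ξ Q E → LowerSqrt3 u → 0ℚ ≤ Q →
          + 2 / 1 * E ≤ (+ 2 / 1 * u - + 3 / 1 + + 2 / 1 * ξ) * Q → ι E ≼ (α/2 ⊕ ι ξ) ⊗ ι Q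
  2e≤⇒≼ {u} ξ Q E u-lower 0≤Q 2E≤ = at-lower-≤⇒≼ u-lower (ι E) ((α/2 ⊕ ι ξ) ⊗ ι Q)
    (subst (0ℚ ≤_) (sym (im-⊗ι (α/2 ⊕ ι ξ) Q)) (0≤n/d 1 1 ⊠ 0≤Q))
    (begin
      ι E at u                                     ≡⟨ at-ι E u ⟩
      E                                            ≤⟨ ≤-by-gap _
        (solve 4 (λ u ξ Q E → (u :- con (+ 3 / 2) :+ ξ) :* Q :- E
          := con ½ :* ((con (+ 2 / 1) :* u :- con (+ 3 / 1) :+ con (+ 2 / 1) :* ξ) :* Q :- con (+ 2 / 1) :* E)) refl u ξ Q E)
        (0≤n/d 1 2 ⊠ p≤q⇒0≤q-p 2E≤) ⟩
      (u - + 3 / 2 + ξ) * Q                        ≡⟨ cong (_* Q) (trans (at-⊕ α/2 (ι ξ) u) (cong₂ _+_ (α/2-at u) (at-ι ξ u))) ⟨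
      (α/2 ⊕ ι ξ) at u * Q                         ≡⟨ at-⊗ι (α/2 ⊕ ι ξ) Q u ⟨
      ((α/2 ⊕ ι ξ) ⊗ ι Q) at u                     ∎)
    where open ≤-Reasoning

module ExtremalInequality where

  open import Data.Integer.Base using (+_)
  open import Data.Rational.Base using (ℚ; 0ℚ; _+_; _-_; _*_; -_; _≤_; _<_; _/_)
  open import Data.Rational.Properties
  open import Data.Rational.Solver using (module +-*-Solver)
  open import Relation.Binary.PropositionalEquality
  open RationalInequalities
  open +-*-Solver

  module Extremal (l h l₂ h₂ : ℚ) where

    k m n : ℚ
    k = l + h
    m = l₂ + h₂
    n = k + m

    slack : ℚ
    slack = k * (l * h) + + 2 / 1 * h * (k - m) * l₂

    -- l, h, l₂, h₂ are the sizes of L₁, H₁, L₂, H₂; e₁₁ and e₂₂ count the edges of G[V₁] and G[V₂]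
    -- twice, e₁₂ those of G[V₁,V₂]; x₁, x₂, z are error terms, and a plays the role of α.
    module Bounds (e₁₁ e₁₂ e₂₂ x₁ x₂ z r a : ℚ)
      (0≤l : 0ℚ ≤ l) (0≤h : 0ℚ ≤ h) (0≤l₂ : 0ℚ ≤ l₂) (0≤h₂ : 0ℚ ≤ h₂)
      (e₁₁≤ : e₁₁ ≤ l * l + + 2 / 1 * (x₁ + z))
      (e₁₂≤ : e₁₂ ≤ h * h₂ + + 2 / 1 * z)
      (e₂₂≤ : e₂₂ ≤ l₂ * m + h₂ * l₂ + x₂)
      (x₁≤r : x₁ ≤ r) (x₂≤r : x₂ ≤ r) (z≤r : z ≤ r) (0≤r : 0ℚ ≤ r)
      (k²+e₂₂≤ : k * k + e₂₂ ≤ a * (n * n))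
      (2km≤ : + 2 / 1 * (k * m) ≤ a * (n * n))
      where

      defect : ℚ → ℚ
      defect b = (a - b) * (n * n) + + 9 / 1 * r

      -- The sum of k·(e₁₁ ≤ …), 2k·(e₁₂ ≤ …), h·(e₂₂ ≤ …), l·(k² + e₂₂ ≤ …) and h·(2km ≤ …): its
      -- quadratic terms cancel up to the slack and h·l₂² ≥ 0.
      weighted-edge-bound :
        k * (e₁₁ + + 2 / 1 * e₁₂ + e₂₂) + slack ≤ k * (a * (n * n) + + 9 / 1 * r)
      weighted-edge-bound = ≤-by-gap _
        (solve 12 (λ l h l₂ h₂ e₁₁ e₁₂ e₂₂ x₁ x₂ z r a →
          let k = l :+ h
              m = l₂ :+ h₂
              n = k :+ m
          in k :* (a :* (n :* n) :+ con (+ 9 / 1) :* r)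
             :- (k :* (e₁₁ :+ con (+ 2 / 1) :* e₁₂ :+ e₂₂) :+ (k :* (l :* h) :+ con (+ 2 / 1) :* h :* (k :- m) :* l₂))
           := k :* (l :* l :+ con (+ 2 / 1) :* (x₁ :+ z) :- e₁₁)
              :+ con (+ 2 / 1) :* k :* (h :* h₂ :+ con (+ 2 / 1) :* z :- e₁₂)
              :+ h :* (l₂ :* m :+ h₂ :* l₂ :+ x₂ :- e₂₂)
              :+ l :* (a :* (n :* n) :- (k :* k :+ e₂₂))
              :+ h :* (a :* (n :* n) :- con (+ 2 / 1) :* (k :* m))
              :+ h :* (l₂ :* l₂)
              :+ con (+ 2 / 1) :* k :* (r :- x₁) :+ con (+ 6 / 1) :* k :* (r :- z) :+ h :* (r :- x₂) :+ l :* r)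
          refl l h l₂ h₂ e₁₁ e₁₂ e₂₂ x₁ x₂ z r a)
        (0≤k ⊠ p≤q⇒0≤q-p e₁₁≤
         ⊞ 0≤n/d 2 1 ⊠ 0≤k ⊠ p≤q⇒0≤q-p e₁₂≤
         ⊞ 0≤h ⊠ p≤q⇒0≤q-p e₂₂≤
         ⊞ 0≤l ⊠ p≤q⇒0≤q-p k²+e₂₂≤
         ⊞ 0≤h ⊠ p≤q⇒0≤q-p 2km≤
         ⊞ 0≤h ⊠ 0≤p*p l₂
         ⊞ 0≤n/d 2 1 ⊠ 0≤k ⊠ p≤q⇒0≤q-p x₁≤r
         ⊞ 0≤n/d 6 1 ⊠ 0≤k ⊠ p≤q⇒0≤q-p z≤r
         ⊞ 0≤h ⊠ p≤q⇒0≤q-p x₂≤r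
         ⊞ 0≤l ⊠ 0≤r)
        where
        0≤k : 0ℚ ≤ k
        0≤k = 0≤l ⊞ 0≤h

      module _ (3n≤5k : + 3 / 1 * n ≤ + 5 / 1 * k) (0<n : 0ℚ < n) where

        private
          0≤k : 0ℚ ≤ k
          0≤k = 0≤l ⊞ 0≤h

          0<k : 0ℚ < k
          0<k = *-cancelˡ-<-nonNeg (+ 5 / 1) (<-≤-trans (*-monoʳ-<-pos (+ 3 / 1) 0<n) 3n≤5k)

          0≤k-m : 0ℚ ≤ k - m
          0≤k-m = subst (0ℚ ≤_)
            (solve 4 (λ l h l₂ h₂ → let k = l :+ h ; m = l₂ :+ h₂ in
              con (+ 1 / 3) :* (con (+ 5 / 1) :* k :- con (+ 3 / 1) :* (k :+ m)) :+ con (+ 1 / 3) :* k := k :- m)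
              refl l h l₂ h₂)
            (0≤n/d 1 3 ⊠ p≤q⇒0≤q-p 3n≤5k ⊞ 0≤n/d 1 3 ⊠ 0≤k)

          k≤n : k ≤ n
          k≤n = p≤p+q (0≤l₂ ⊞ 0≤h₂)

          0≤slack : 0ℚ ≤ slack
          0≤slack = 0≤k ⊠ (0≤l ⊠ 0≤h) ⊞ 0≤n/d 2 1 ⊠ 0≤h ⊠ 0≤k-m ⊠ 0≤l₂

        edge-bound : e₁₁ + + 2 / 1 * e₁₂ + e₂₂ ≤ a * (n * n) + + 9 / 1 * r
        edge-bound = *-cancelˡ-≤-0< 0<k (≤-trans (p≤p+q 0≤slack) weighted-edge-bound)

        module _ {b : ℚ} (b≤ : b * (n * n) ≤ e₁₁ + + 2 / 1 * e₁₂ + e₂₂) where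

          private
            slack≤ : slack ≤ k * defect b
            slack≤ = ≤-by-gap _
              (solve 11 (λ l h l₂ h₂ e₁₁ e₁₂ e₂₂ r a b s →
                let k = l :+ h ; m = l₂ :+ h₂ ; n = k :+ m ; t = e₁₁ :+ con (+ 2 / 1) :* e₁₂ :+ e₂₂ in
                k :* ((a :- b) :* (n :* n) :+ con (+ 9 / 1) :* r) :- s
                  := k :* (a :* (n :* n) :+ con (+ 9 / 1) :* r) :- (k :* t :+ s) :+ k :* (t :- b :* (n :* n)))
                refl l h l₂ h₂ e₁₁ e₁₂ e₂₂ r a b slack)
              (p≤q⇒0≤q-p weighted-edge-bound ⊞ 0≤k ⊠ p≤q⇒0≤q-p b≤)

            lh≤defect : l * h ≤ defect b
            lh≤defect = *-cancelˡ-≤-0< 0<k (≤-trans (p≤p+q (0≤n/d 2 1 ⊠ 0≤h ⊠ 0≤k-m ⊠ 0≤l₂)) slack≤)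

            0≤defect : 0ℚ ≤ defect b
            0≤defect = ≤-trans (0≤l ⊠ 0≤h) lh≤defect

            2h[k-m]l₂≤ndefect : + 2 / 1 * h * (k - m) * l₂ ≤ n * defect b
            2h[k-m]l₂≤ndefect = ≤-trans (q≤p+q {q = + 2 / 1 * h * (k - m) * l₂} (0≤k ⊠ (0≤l ⊠ 0≤h)))
              (≤-trans slack≤ (*-monoʳ-≤-0≤ 0≤defect k≤n))

          few-crossing-edges : ∀ {θ} → 0ℚ ≤ θ → θ * n < l → θ * e₁₂ ≤ defect b + + 2 / 1 * θ * r
          few-crossing-edges {θ} 0≤θ θn<l = ≤-by-gap _
            (solve 9 (λ l h l₂ h₂ e₁₂ z r θ d →
              let n = l :+ h :+ (l₂ :+ h₂) in
              d :+ con (+ 2 / 1) :* θ :* r :- θ :* e₁₂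
                := θ :* (h :* h₂ :+ con (+ 2 / 1) :* z :- e₁₂) :+ θ :* h :* (l :+ h :+ l₂) :+ (d :- l :* h)
                   :+ h :* (l :- θ :* n) :+ con (+ 2 / 1) :* θ :* (r :- z))
              refl l h l₂ h₂ e₁₂ z r θ (defect b))
            (0≤θ ⊠ p≤q⇒0≤q-p e₁₂≤ ⊞ 0≤θ ⊠ 0≤h ⊠ (0≤l ⊞ 0≤h ⊞ 0≤l₂) ⊞ p≤q⇒0≤q-p lh≤defect
              ⊞ 0≤h ⊠ p≤q⇒0≤q-p (<⇒≤ θn<l) ⊞ 0≤n/d 2 1 ⊠ 0≤θ ⊠ p≤q⇒0≤q-p z≤r)

          few-inner-edges : ∀ {θ} → θ ≤ + 1 / 5 → l ≤ θ * n →
            e₁₁ + e₂₂ ≤ θ * θ * (n * n) + + 5 / 1 * r + + 25 / 2 * defect b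
          few-inner-edges {θ} θ≤1/5 l≤θn = ≤-by-gap _
            (solve 12 (λ l h l₂ h₂ e₁₁ e₂₂ x₁ x₂ z r θ d →
              let k = l :+ h ; m = l₂ :+ h₂ ; n = k :+ m in
              θ :* θ :* (n :* n) :+ con (+ 5 / 1) :* r :+ con (+ 25 / 2) :* d :- (e₁₁ :+ e₂₂)
                := l :* l :+ con (+ 2 / 1) :* (x₁ :+ z) :- e₁₁ :+ (l₂ :* m :+ h₂ :* l₂ :+ x₂ :- e₂₂)
                   :+ (θ :* n :* (θ :* n) :- l :* l)
                   :+ con (+ 2 / 1) :* (r :- x₁) :+ con (+ 2 / 1) :* (r :- z) :+ (r :- x₂)
                   :+ con (+ 2 / 1) :* (con (+ 25 / 4) :* d :- n :* l₂) :+ l₂ :* (con (+ 2 / 1) :* k :+ l₂))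
              refl l h l₂ h₂ e₁₁ e₂₂ x₁ x₂ z r θ (defect b))
            (p≤q⇒0≤q-p e₁₁≤ ⊞ p≤q⇒0≤q-p e₂₂≤ ⊞ p≤q⇒0≤q-p (square-mono-≤ 0≤l l≤θn)
              ⊞ 0≤n/d 2 1 ⊠ p≤q⇒0≤q-p x₁≤r ⊞ 0≤n/d 2 1 ⊠ p≤q⇒0≤q-p z≤r ⊞ p≤q⇒0≤q-p x₂≤r
              ⊞ 0≤n/d 2 1 ⊠ p≤q⇒0≤q-p nl₂≤ ⊞ 0≤l₂ ⊠ (0≤n/d 2 1 ⊠ 0≤k ⊞ 0≤l₂))
            where
            2n≤5h : + 2 / 1 * n ≤ + 5 / 1 * h
            2n≤5h = ≤-by-gap _
              (solve 5 (λ l h l₂ h₂ θ → let k = l :+ h ; n = k :+ (l₂ :+ h₂) in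
                con (+ 5 / 1) :* h :- con (+ 2 / 1) :* n
                  := con (+ 5 / 1) :* k :- con (+ 3 / 1) :* n :+ con (+ 5 / 1) :* (θ :* n :- l)
                     :+ con (+ 5 / 1) :* n :* (con (+ 1 / 5) :- θ))
                refl l h l₂ h₂ θ)
              (p≤q⇒0≤q-p 3n≤5k ⊞ 0≤n/d 5 1 ⊠ p≤q⇒0≤q-p l≤θn ⊞ 0≤n/d 5 1 ⊠ <⇒≤ 0<n ⊠ p≤q⇒0≤q-p θ≤1/5)

            n≤5[k-m] : n ≤ + 5 / 1 * (k - m)
            n≤5[k-m] = ≤-by-gap _
              (solve 4 (λ l h l₂ h₂ → let k = l :+ h ; m = l₂ :+ h₂ ; n = k :+ m in
                con (+ 5 / 1) :* (k :- m) :- n := con (+ 2 / 1) :* (con (+ 5 / 1) :* k :- con (+ 3 / 1) :* n))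
                refl l h l₂ h₂)
              (0≤n/d 2 1 ⊠ p≤q⇒0≤q-p 3n≤5k)

            nl₂≤ : n * l₂ ≤ + 25 / 4 * defect b
            nl₂≤ = *-cancelˡ-≤-0< 0<n (≤-by-gap _
              (solve 5 (λ l h l₂ h₂ d → let k = l :+ h ; m = l₂ :+ h₂ ; n = k :+ m in
                n :* (con (+ 25 / 4) :* d) :- n :* (n :* l₂)
                  := con (+ 25 / 4) :* (n :* d :- con (+ 2 / 1) :* h :* (k :- m) :* l₂)
                     :+ con (+ 5 / 2) :* l₂ :* (con (+ 5 / 1) :* h :- con (+ 2 / 1) :* n) :* (k :- m)
                     :+ l₂ :* n :* (con (+ 5 / 1) :* (k :- m) :- n))
                refl l h l₂ h₂ (defect b))
              (0≤n/d 25 4 ⊠ p≤q⇒0≤q-p 2h[k-m]l₂≤ndefect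
                ⊞ 0≤n/d 5 2 ⊠ 0≤l₂ ⊠ p≤q⇒0≤q-p 2n≤5h ⊠ 0≤k-m
                ⊞ 0≤l₂ ⊠ <⇒≤ 0<n ⊠ p≤q⇒0≤q-p n≤5[k-m]))

module SizeBracket where

  open import Data.Integer.Base using (+_)
  open import Data.Rational.Base using (ℚ; 0ℚ; 1ℚ; _+_; _-_; _*_; -_; _≤_; _/_)
  open import Data.Rational.Properties
  open import Data.Rational.Solver using (module +-*-Solver)
  open import Relation.Binary.PropositionalEquality
  open import Relation.Nullary.Decidable using (toWitness)
  open import Data.Unit using (tt)
  open RationalInequalities
  open Sqrt3Order
  open +-*-Solver

  -- The two quadratic bounds of the extremal inequality, k² + αm² ≤ αn² and 2km ≤ αn², which are
  -- tight at k = γn; here α and γ are replaced by their brackets.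
  module _ {u v : ℚ} (u-lower : LowerSqrt3 u) (v-upper : UpperSqrt3 v) where

    open LowerSqrt3 u-lower renaming (nonNeg to 0≤u; sq≤3 to u²≤3)
    open UpperSqrt3 v-upper renaming (nonNeg to 0≤v; 3≤sq to 3≤v²)

    u≤v : u ≤ v
    u≤v = square-cancel-≤ 0≤v (≤-trans u²≤3 3≤v²)

    1≤v : 1ℚ ≤ v
    1≤v = square-cancel-≤ 0≤v (≤-trans (toWitness {a? = 1ℚ * 1ℚ ≤? + 3 / 1} tt) 3≤v²)

    2km≤ : ∀ {k m} → v ≤ + 2 / 1 → 0ℚ ≤ k → 0ℚ ≤ m → (+ 3 / 1 - v) * (k + m) ≤ + 2 / 1 * k →
           + 2 / 1 * (k * m) ≤ (+ 2 / 1 * v - + 3 / 1) * ((k + m) * (k + m))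
    2km≤ {k} {m} v≤2 0≤k 0≤m lower-k = ≤-by-gap _
      (solve 3 (λ k m v → let n = k :+ m ; x = con (+ 2 / 1) :* k :- (con (+ 3 / 1) :- v) :* n in
        (con (+ 2 / 1) :* v :- con (+ 3 / 1)) :* (n :* n) :- con (+ 2 / 1) :* (k :* m)
          := con (+ 1 / 2) :* (v :* v :- con (+ 3 / 1)) :* (n :* n) :+ con (+ 1 / 2) :* (x :* x)
             :+ (con (+ 2 / 1) :- v) :* x :* n)
        refl k m v)
      (0≤n/d 1 2 ⊠ p≤q⇒0≤q-p 3≤v² ⊠ 0≤p*p (k + m) ⊞ 0≤n/d 1 2 ⊠ 0≤p*p (+ 2 / 1 * k - (+ 3 / 1 - v) * (k + m))
        ⊞ p≤q⇒0≤q-p v≤2 ⊠ p≤q⇒0≤q-p lower-k ⊠ (0≤k ⊞ 0≤m))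

    k²+e≤ : ∀ {k m e} → 0ℚ ≤ k → 0ℚ ≤ m → + 2 / 1 * k ≤ (+ 3 / 1 - u) * (k + m) →
            e ≤ (+ 2 / 1 * v - + 3 / 1) * (m * m) →
            k * k + e ≤ (+ 2 / 1 * v - + 3 / 1 + (v * v - u * u)) * ((k + m) * (k + m))
    k²+e≤ {k} {m} {e} 0≤k 0≤m upper-k e≤ = ≤-by-gap _
      (solve 5 (λ k m e u v → let n = k :+ m ; y = (con (+ 3 / 1) :- u) :* n :- con (+ 2 / 1) :* k in
        (con (+ 2 / 1) :* v :- con (+ 3 / 1) :+ (v :* v :- u :* u)) :* (n :* n) :- (k :* k :+ e)
          := (con (+ 2 / 1) :* v :- con (+ 3 / 1)) :* (m :* m) :- e
             :+ k :* n :* (v :- u) :+ k :* n :* u :* (v :- u) :+ (con (+ 3 / 1) :- u :* u) :* n :* m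
             :+ (v :* v :- con (+ 3 / 1)) :* (n :* n) :+ k :* (v :- con (+ 1 / 1)) :* y)
        refl k m e u v)
      (p≤q⇒0≤q-p e≤ ⊞ 0≤k ⊠ 0≤n ⊠ 0≤v-u ⊞ 0≤k ⊠ 0≤n ⊠ 0≤u ⊠ 0≤v-u ⊞ p≤q⇒0≤q-p u²≤3 ⊠ 0≤n ⊠ 0≤m
        ⊞ p≤q⇒0≤q-p 3≤v² ⊠ 0≤p*p (k + m) ⊞ 0≤k ⊠ p≤q⇒0≤q-p 1≤v ⊠ p≤q⇒0≤q-p upper-k)
      where
      0≤n : 0ℚ ≤ k + m
      0≤n = 0≤k ⊞ 0≤m
      0≤v-u : 0ℚ ≤ v - u
      0≤v-u = p≤q⇒0≤q-p u≤v

module Parameters where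

  open import Data.Nat.Base as ℕ using (ℕ; zero; suc; z≤n; s≤s)
  import Data.Nat.Properties as ℕ
  open import Data.Integer.Base using (+_; +[1+_])
  open import Data.Rational.Base using (ℚ; mkℚ; 0ℚ; 1ℚ; ½; _+_; _-_; _*_; _≤_; _<_; _/_; ↧ₙ_; *≤*; *<*)
  open import Data.Rational.Properties
  open import Data.Rational.Solver using (module +-*-Solver)
  import Data.Integer as ℤ
  open import Data.Product using (∃-syntax; _×_; _,_; proj₁; proj₂)
  open import Relation.Nullary using (yes; no)
  open import Relation.Binary.PropositionalEquality
  open import Relation.Nullary.Decidable using (toWitness)
  open import Data.Unit using (tt)
  open RationalInequalities
  open Sqrt3Order
  open +-*-Solver

  integer-sqrt : ∀ N → ∃[ a ] a ℕ.* a ℕ.≤ N × N ℕ.< suc a ℕ.* suc a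
  integer-sqrt zero = 0 , z≤n , s≤s z≤n
  integer-sqrt (suc N) with integer-sqrt N
  ... | a , a²≤N , N<[1+a]² with suc a ℕ.* suc a ℕ.≤? suc N
  ...   | yes [1+a]²≤1+N = suc a , [1+a]²≤1+N , ℕ.≤-<-trans N<[1+a]² (ℕ.*-mono-< (ℕ.n<1+n (suc a)) (ℕ.n<1+n (suc a)))
  ...   | no  [1+a]²≰1+N = a , ℕ.m≤n⇒m≤1+n a²≤N , ℕ.≰⇒> [1+a]²≰1+N

  1/↧≤ : ∀ ξ → 0ℚ < ξ → 1/ℕ (↧ₙ ξ) ≤ ξ
  1/↧≤ (mkℚ +[1+ p ] d _) _ = *≤* (ℤ.+≤+ (s≤s (ℕ.+-monoʳ-≤ d z≤n)))
  1/↧≤ (mkℚ (+ 0) _ _) (*<* (ℤ.+<+ ()))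
  1/↧≤ (mkℚ ℤ.-[1+ _ ] _ _) (*<* ())

  module Numerics (ε ξ ρ : ℚ)
    (0≤ε : 0ℚ ≤ ε) (ε≤1 : ε ≤ 1ℚ) (ε≤ξ : ε ≤ ξ) (1000ρ≤ε² : + 1000 / 1 * ρ ≤ ε * ε) where

    θ : ℚ
    θ = ε * (+ 1 / 5)

    total-slack : + 21 / 1 * ρ ≤ + 2 / 1 * ξ
    total-slack = ≤-by-gap _
      (solve 3 (λ ε ξ ρ → con (+ 2 / 1) :* ξ :- con (+ 21 / 1) :* ρ
        := con (+ 2 / 1) :* (ξ :- ε) :+ con (+ 21 / 1000) :* (ε :* ε :- con (+ 1000 / 1) :* ρ)
           :+ con (+ 21 / 1000) :* ε :* (con 1ℚ :- ε) :+ con (+ 1979 / 1000) :* ε) refl ε ξ ρ)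
      (0≤n/d 2 1 ⊠ p≤q⇒0≤q-p ε≤ξ ⊞ 0≤n/d 21 1000 ⊠ p≤q⇒0≤q-p 1000ρ≤ε²
        ⊞ 0≤n/d 21 1000 ⊠ 0≤ε ⊠ p≤q⇒0≤q-p ε≤1 ⊞ 0≤n/d 1979 1000 ⊠ 0≤ε)

    crossing-slack : + 21 / 1 * ρ + + 2 / 1 * θ * ρ ≤ θ * ξ
    crossing-slack = ≤-by-gap _
      (solve 3 (λ ε ξ ρ → ε :* con (+ 1 / 5) :* ξ :- (con (+ 21 / 1) :* ρ :+ con (+ 2 / 1) :* (ε :* con (+ 1 / 5)) :* ρ)
        := con (+ 1 / 5) :* ε :* (ξ :- ε) :+ con (+ 21 / 1000) :* (ε :* ε :- con (+ 1000 / 1) :* ρ)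
           :+ con (+ 2 / 5000) :* ε :* (ε :* ε :- con (+ 1000 / 1) :* ρ)
           :+ con (+ 2 / 5000) :* (ε :* ε) :* (con 1ℚ :- ε) :+ con (+ 893 / 5000) :* (ε :* ε)) refl ε ξ ρ)
      (0≤n/d 1 5 ⊠ 0≤ε ⊠ p≤q⇒0≤q-p ε≤ξ ⊞ 0≤n/d 21 1000 ⊠ p≤q⇒0≤q-p 1000ρ≤ε²
        ⊞ 0≤n/d 2 5000 ⊠ 0≤ε ⊠ p≤q⇒0≤q-p 1000ρ≤ε²
        ⊞ 0≤n/d 2 5000 ⊠ 0≤p*p ε ⊠ p≤q⇒0≤q-p ε≤1 ⊞ 0≤n/d 893 5000 ⊠ 0≤p*p ε)

    inner-slack : θ * θ + + 5 / 1 * ρ + + 25 / 2 * (+ 21 / 1 * ρ) ≤ + 2 / 1 * ξ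
    inner-slack = ≤-by-gap _
      (solve 3 (λ ε ξ ρ → con (+ 2 / 1) :* ξ :- (ε :* con (+ 1 / 5) :* (ε :* con (+ 1 / 5)) :+ con (+ 5 / 1) :* ρ
                                                 :+ con (+ 25 / 2) :* (con (+ 21 / 1) :* ρ))
        := con (+ 2 / 1) :* (ξ :- ε) :+ con (+ 535 / 2000) :* (ε :* ε :- con (+ 1000 / 1) :* ρ)
           :+ con (+ 615 / 2000) :* ε :* (con 1ℚ :- ε) :+ con (+ 3385 / 2000) :* ε) refl ε ξ ρ)
      (0≤n/d 2 1 ⊠ p≤q⇒0≤q-p ε≤ξ ⊞ 0≤n/d 535 2000 ⊠ p≤q⇒0≤q-p 1000ρ≤ε²
        ⊞ 0≤n/d 615 2000 ⊠ 0≤ε ⊠ p≤q⇒0≤q-p ε≤1 ⊞ 0≤n/d 3385 2000 ⊠ 0≤ε)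

  -- ε = 1/K ≤ ξ; degrees are compared with n/M where M = 1000K²; ρ = 1/M = ε²/1000 bounds the
  -- error terms relative to n²; δ = ρ³/4 makes δn⁴ paths cost at most ρn² pairs; and s = a/M,
  -- t = (a + 1)/M with a = ⌊√3·M⌋ bracket √3, widened to u, v by the tolerance 2δ.
  module Constants (ξ : ℚ) where

    K M : ℕ
    K = ↧ₙ ξ
    M = 1000 ℕ.* (K ℕ.* K)

    -- Opaque, since unfolding them evaluates unary numerals such as 1000K², or integer-sqrt on 3M².
    opaque
      ε ρ : ℚ
      ε = 1/ℕ K
      ρ = 1/ℕ M

      0<ε : 0ℚ < ε
      0<ε = *<* (ℤ.+<+ (s≤s z≤n))

      ε≤1 : ε ≤ 1ℚ
      ε≤1 = *≤* (ℤ.+≤+ (s≤s z≤n))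

      ε≤ξ : 0ℚ < ξ → ε ≤ ξ
      ε≤ξ = 1/↧≤ ξ

      0<ρ : 0ℚ < ρ
      0<ρ = *<* (ℤ.+<+ (s≤s z≤n))

      ρM≡1 : ρ * ℕ→ℚ M ≡ 1ℚ
      ρM≡1 = 1/ℕ-inverse M

      εK≡1 : ε * ℕ→ℚ K ≡ 1ℚ
      εK≡1 = 1/ℕ-inverse K

      a : ℕ
      a = proj₁ (integer-sqrt (3 ℕ.* (M ℕ.* M)))

      a²≤3M² : a ℕ.* a ℕ.≤ 3 ℕ.* (M ℕ.* M)
      a²≤3M² = proj₁ (proj₂ (integer-sqrt (3 ℕ.* (M ℕ.* M))))

      3M²<[1+a]² : 3 ℕ.* (M ℕ.* M) ℕ.< suc a ℕ.* suc a
      3M²<[1+a]² = proj₂ (proj₂ (integer-sqrt (3 ℕ.* (M ℕ.* M))))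

    δ : ℚ
    δ = ρ * ρ * ρ * (+ 1 / 4)

    s t u v : ℚ
    s = ℕ→ℚ a * ρ
    t = ℕ→ℚ (suc a) * ρ
    u = s - + 2 / 1 * δ
    v = t + + 2 / 1 * δ

    M≡1000K² : ℕ→ℚ M ≡ + 1000 / 1 * (ℕ→ℚ K * ℕ→ℚ K)
    M≡1000K² = trans (ℕ→ℚ-* 1000 (K ℕ.* K)) (cong (+ 1000 / 1 *_) (ℕ→ℚ-* K K))

    1000ρ≡ε² : + 1000 / 1 * ρ ≡ ε * ε
    1000ρ≡ε² = begin
      + 1000 / 1 * ρ                                  ≡⟨ solve 1 (λ x → x := x :* con 1ℚ :* con 1ℚ) refl _ ⟩
      + 1000 / 1 * ρ * 1ℚ * 1ℚ                        ≡⟨ cong (λ x → + 1000 / 1 * ρ * x * x) εK≡1 ⟨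
      + 1000 / 1 * ρ * (ε * ℕ→ℚ K) * (ε * ℕ→ℚ K)      ≡⟨ solve 3 (λ ρ ε k → con (+ 1000 / 1) :* ρ :* (ε :* k) :* (ε :* k)
                                                           := ε :* ε :* (ρ :* (con (+ 1000 / 1) :* (k :* k)))) refl ρ ε (ℕ→ℚ K) ⟩
      ε * ε * (ρ * (+ 1000 / 1 * (ℕ→ℚ K * ℕ→ℚ K)))   ≡⟨ cong (λ m → ε * ε * (ρ * m)) M≡1000K² ⟨
      ε * ε * (ρ * ℕ→ℚ M)                             ≡⟨ cong (ε * ε *_) ρM≡1 ⟩
      ε * ε * 1ℚ                                      ≡⟨ *-identityʳ (ε * ε) ⟩
      ε * ε                                           ∎
      where open ≡-Reasoning

    private
      [j*j]ρ² : ∀ j → ℕ→ℚ (j ℕ.* j) * (ρ * ρ) ≡ ℕ→ℚ j * ρ * (ℕ→ℚ j * ρ)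
      [j*j]ρ² j = trans (cong (_* (ρ * ρ)) (ℕ→ℚ-* j j))
        (solve 2 (λ x ρ → x :* x :* (ρ :* ρ) := x :* ρ :* (x :* ρ)) refl (ℕ→ℚ j) ρ)

      [3M²]ρ²≡3 : ℕ→ℚ (3 ℕ.* (M ℕ.* M)) * (ρ * ρ) ≡ + 3 / 1
      [3M²]ρ²≡3 = begin
        ℕ→ℚ (3 ℕ.* (M ℕ.* M)) * (ρ * ρ)       ≡⟨ cong (λ x → x * (ρ * ρ)) (trans (ℕ→ℚ-* 3 (M ℕ.* M)) (cong (+ 3 / 1 *_) (ℕ→ℚ-* M M))) ⟩
        + 3 / 1 * (ℕ→ℚ M * ℕ→ℚ M) * (ρ * ρ)  ≡⟨ solve 2 (λ m ρ → con (+ 3 / 1) :* (m :* m) :* (ρ :* ρ)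
                                                  := con (+ 3 / 1) :* (ρ :* m) :* (ρ :* m)) refl (ℕ→ℚ M) ρ ⟩
        + 3 / 1 * (ρ * ℕ→ℚ M) * (ρ * ℕ→ℚ M)  ≡⟨ cong (λ x → + 3 / 1 * x * x) ρM≡1 ⟩
        + 3 / 1                                ∎
        where open ≡-Reasoning

      0≤ρ : 0ℚ ≤ ρ
      0≤ρ = <⇒≤ 0<ρ

      ρ²-mono : ∀ {i j} → i ℕ.≤ j → ℕ→ℚ i * (ρ * ρ) ≤ ℕ→ℚ j * (ρ * ρ)
      ρ²-mono i≤j = *-monoʳ-≤-0≤ (0≤p*p ρ) (ℕ→ℚ-mono-≤ i≤j)

      1≤s : 1ℚ ≤ s
      1≤s = begin
        1ℚ            ≡⟨ trans (sym ρM≡1) (*-comm ρ (ℕ→ℚ M)) ⟩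
        ℕ→ℚ M * ρ     ≤⟨ *-monoʳ-≤-0≤ 0≤ρ (ℕ→ℚ-mono-≤ M≤a) ⟩
        s             ∎
        where
        open ≤-Reasoning
        M≤a : M ℕ.≤ a
        M≤a = ℕ.≮⇒≥ λ a<M → ℕ.<⇒≱ 3M²<[1+a]²
          (ℕ.≤-trans (ℕ.*-mono-≤ a<M a<M) (ℕ.m≤n*m (M ℕ.* M) 3))

      ρ≤1 : ρ ≤ 1ℚ
      ρ≤1 = *-cancelˡ-≤-0< (positive⁻¹ (+ 1000 / 1)) (begin
        + 1000 / 1 * ρ     ≡⟨ 1000ρ≡ε² ⟩
        ε * ε              ≤⟨ *-mono-≤-0≤ (<⇒≤ 0<ε) (0≤n/d 1 1) ε≤1 ε≤1 ⟩
        1ℚ * 1ℚ            ≤⟨ toWitness {a? = 1ℚ * 1ℚ ≤? + 1000 / 1 * 1ℚ} tt ⟩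
        + 1000 / 1 * 1ℚ    ∎)
        where open ≤-Reasoning

    s-lower : LowerSqrt3 s
    s-lower = record
      { nonNeg = 0≤ℕ→ℚ a ⊠ 0≤ρ
      ; sq≤3   = subst₂ _≤_ ([j*j]ρ² a) [3M²]ρ²≡3 (ρ²-mono a²≤3M²)
      }

    t-upper : UpperSqrt3 t
    t-upper = record
      { nonNeg = 0≤ℕ→ℚ (suc a) ⊠ 0≤ρ
      ; 3≤sq   = subst₂ _≤_ [3M²]ρ²≡3 ([j*j]ρ² (suc a)) (ρ²-mono (ℕ.<⇒≤ 3M²<[1+a]²))
      }

    0<δ : 0ℚ < δ
    0<δ = *-pres-0< (*-pres-0< (*-pres-0< 0<ρ 0<ρ) 0<ρ) (positive⁻¹ (+ 1 / 4))

    private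
      0≤δ : 0ℚ ≤ δ
      0≤δ = <⇒≤ 0<δ

      4δ≤ρ : + 4 / 1 * δ ≤ ρ
      4δ≤ρ = ≤-by-gap _
        (solve 1 (λ ρ → ρ :- con (+ 4 / 1) :* (ρ :* ρ :* ρ :* con (+ 1 / 4)) := ρ :* (con 1ℚ :- ρ) :* (con 1ℚ :+ ρ)) refl ρ)
        (0≤ρ ⊠ p≤q⇒0≤q-p ρ≤1 ⊠ (0≤n/d 1 1 ⊞ 0≤ρ))

      ρ≤1/1000 : ρ ≤ + 1 / 1000
      ρ≤1/1000 = ≤-by-gap _
        (solve 2 (λ ρ ε → con (+ 1 / 1000) :- ρ
          := con (+ 1 / 1000) :* (con 1ℚ :- ε :* ε) :+ con (+ 1 / 1000) :* (ε :* ε :- con (+ 1000 / 1) :* ρ)) refl ρ ε)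
        (0≤n/d 1 1000 ⊠ p≤q⇒0≤q-p (*-mono-≤-0≤ (<⇒≤ 0<ε) (0≤n/d 1 1) ε≤1 ε≤1)
          ⊞ 0≤n/d 1 1000 ⊠ p≤q⇒0≤q-p (≤-reflexive 1000ρ≡ε²))

      s≤7/4 : s ≤ + 7 / 4
      s≤7/4 = square-cancel-≤ (0≤n/d 7 4) (≤-trans (LowerSqrt3.sq≤3 s-lower) (toWitness {a? = + 3 / 1 ≤? + 7 / 4 * (+ 7 / 4)} tt))

      t≡s+ρ : t ≡ s + ρ
      t≡s+ρ = trans (cong (_* ρ) (ℕ→ℚ-+ 1 a)) (solve 2 (λ x ρ → (con 1ℚ :+ x) :* ρ := x :* ρ :+ ρ) refl (ℕ→ℚ a) ρ)

      u≤s : u ≤ s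
      u≤s = ≤-by-gap _ (solve 2 (λ s δ → s :- (s :- con (+ 2 / 1) :* δ) := con (+ 2 / 1) :* δ) refl s δ) (0≤n/d 2 1 ⊠ 0≤δ)

      t≤v : t ≤ v
      t≤v = p≤p+q {t} {+ 2 / 1 * δ} (0≤n/d 2 1 ⊠ 0≤δ)

      0≤u : 0ℚ ≤ u
      0≤u = ≤-by-gap _
        (solve 3 (λ s ρ δ → s :- con (+ 2 / 1) :* δ :- con 0ℚ
          := s :- con 1ℚ :+ con ½ :* (ρ :- con (+ 4 / 1) :* δ) :+ con ½ :* (con 1ℚ :- ρ) :+ con ½) refl s ρ δ)
        (p≤q⇒0≤q-p 1≤s ⊞ 0≤n/d 1 2 ⊠ p≤q⇒0≤q-p 4δ≤ρ ⊞ 0≤n/d 1 2 ⊠ p≤q⇒0≤q-p ρ≤1 ⊞ 0≤n/d 1 2)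

    u-lower : LowerSqrt3 u
    u-lower = record
      { nonNeg = 0≤u
      ; sq≤3   = ≤-trans (square-mono-≤ 0≤u u≤s) (LowerSqrt3.sq≤3 s-lower)
      }

    v-upper : UpperSqrt3 v
    v-upper = record
      { nonNeg = ≤-trans (UpperSqrt3.nonNeg t-upper) t≤v
      ; 3≤sq   = ≤-trans (UpperSqrt3.3≤sq t-upper) (square-mono-≤ (UpperSqrt3.nonNeg t-upper) t≤v)
      }

    v≤9/5 : v ≤ + 9 / 5
    v≤9/5 = ≤-by-gap _
      (trans (cong (λ t → + 9 / 5 - (t + + 2 / 1 * δ)) t≡s+ρ)
        (solve 3 (λ s ρ δ → con (+ 9 / 5) :- (s :+ ρ :+ con (+ 2 / 1) :* δ)
          := con (+ 7 / 4) :- s :+ con ½ :* (ρ :- con (+ 4 / 1) :* δ) :+ con (+ 3 / 2) :* (con (+ 1 / 1000) :- ρ)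
             :+ con (+ 97 / 2000)) refl s ρ δ))
      (p≤q⇒0≤q-p s≤7/4 ⊞ 0≤n/d 1 2 ⊠ p≤q⇒0≤q-p 4δ≤ρ ⊞ 0≤n/d 3 2 ⊠ p≤q⇒0≤q-p ρ≤1/1000 ⊞ 0≤n/d 97 2000)

    private
      v-u≤2ρ : v - u ≤ + 2 / 1 * ρ
      v-u≤2ρ = ≤-by-gap _
        (trans (cong (λ t → + 2 / 1 * ρ - (t + + 2 / 1 * δ - u)) t≡s+ρ)
          (solve 3 (λ s ρ δ → con (+ 2 / 1) :* ρ :- (s :+ ρ :+ con (+ 2 / 1) :* δ :- (s :- con (+ 2 / 1) :* δ))
            := ρ :- con (+ 4 / 1) :* δ) refl s ρ δ))
        (p≤q⇒0≤q-p 4δ≤ρ)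

      u+v≤4 : u + v ≤ + 4 / 1
      u+v≤4 = ≤-trans (+-mono-≤ (≤-trans u≤s s≤7/4) v≤9/5) (toWitness {a? = + 7 / 4 + + 9 / 5 ≤? + 4 / 1} tt)

    bracket-defect : + 2 / 1 * v - + 3 / 1 + (v * v - u * u) - (+ 2 / 1 * u - + 3 / 1) + + 9 / 1 * ρ ≤ + 21 / 1 * ρ
    bracket-defect = ≤-by-gap _
      (solve 3 (λ u v ρ →
        con (+ 21 / 1) :* ρ
          :- (con (+ 2 / 1) :* v :- con (+ 3 / 1) :+ (v :* v :- u :* u) :- (con (+ 2 / 1) :* u :- con (+ 3 / 1)) :+ con (+ 9 / 1) :* ρ)
          := (con (+ 2 / 1) :+ u :+ v) :* (con (+ 2 / 1) :* ρ :- (v :- u)) :+ con (+ 2 / 1) :* ρ :* (con (+ 4 / 1) :- (u :+ v)))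
        refl u v ρ)
      ((0≤n/d 2 1 ⊞ 0≤u ⊞ UpperSqrt3.nonNeg v-upper) ⊠ p≤q⇒0≤q-p v-u≤2ρ
        ⊞ 0≤n/d 2 1 ⊠ 0≤ρ ⊠ p≤q⇒0≤q-p u+v≤4)

open import Defs hiding (sym)
open import Data.Nat using (ℕ; _^_)
open import Data.Integer using (+_)
open import Data.Rational using (ℚ; 0ℚ; _/_; _<_; _≤_; _*_)
open import Data.Bool using (Bool; not)
open import Data.Fin using (Fin)
open import Data.Product using (Σ; _×_)
open import Data.Sum using (_⊎_)
open import Data.Nat.Base as ℕ using (z≤n; s≤s)
import Data.Nat.Properties as ℕ
import Data.Nat.DivMod as ℕ
open import Data.Rational.Base using (1ℚ; ½; _+_; _-_)
open import Data.Rational.Properties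
open import Data.Rational.Solver using (module +-*-Solver)
open import Data.Bool.Base using (_∧_)
open import Data.Product using (_,_)
import Data.Sum as Sum
open import Function.Base using (_∘_)
open import Relation.Nullary.Decidable using (toSum; toWitness)
open import Relation.Binary.PropositionalEquality
open import Data.Unit using (tt)
open RationalInequalities
open Sqrt3Order
open ExtremalInequality
open FiniteSums
open GraphCounting
open Parameters
open +-*-Solver

module Proof (ξ : ℚ) (0<ξ : 0ℚ < ξ) where

  open Constants ξ public
  open Numerics ε ξ ρ (<⇒≤ 0<ε) ε≤1 (ε≤ξ 0<ξ) (≤-reflexive 1000ρ≡ε²) public

  private
    0≤ρ : 0ℚ ≤ ρ
    0≤ρ = <⇒≤ 0<ρ

    4M²δ≡ρ : + 4 / 1 * (ℕ→ℚ M * ℕ→ℚ M) * δ ≡ ρ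
    4M²δ≡ρ = begin
      + 4 / 1 * (ℕ→ℚ M * ℕ→ℚ M) * δ       ≡⟨ solve 2 (λ m ρ → con (+ 4 / 1) :* (m :* m) :* (ρ :* ρ :* ρ :* con (+ 1 / 4))
                                                  := ρ :* (ρ :* m) :* (ρ :* m)) refl (ℕ→ℚ M) ρ ⟩
      ρ * (ρ * ℕ→ℚ M) * (ρ * ℕ→ℚ M)       ≡⟨ cong (λ x → ρ * x * x) ρM≡1 ⟩
      ρ * 1ℚ * 1ℚ                         ≡⟨ solve 1 (λ ρ → ρ :* con 1ℚ :* con 1ℚ := ρ) refl ρ ⟩
      ρ                                   ∎
      where open ≡-Reasoning

  xT²≤δN⁴⇒x≤ρN² : ∀ x T N → 0ℚ ≤ x → 0ℚ < N → N ≤ + 2 / 1 * (T * ℕ→ℚ M) →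
    x * (T * T) ≤ δ * (N * (N * (N * N))) → x ≤ ρ * (N * N)
  xT²≤δN⁴⇒x≤ρN² x T N 0≤x 0<N N≤2MT xT²≤ = *-cancelˡ-≤-0< (*-pres-0< 0<N 0<N) (≤-by-gap _
    (trans (cong (λ w → N * N * (w * (N * N)) - N * N * x) (sym 4M²δ≡ρ))
      (solve 5 (λ x T N m δ → N :* N :* (con (+ 4 / 1) :* (m :* m) :* δ :* (N :* N)) :- N :* N :* x
        := con (+ 4 / 1) :* (m :* m) :* (δ :* (N :* (N :* (N :* N))) :- x :* (T :* T))
           :+ x :* (con (+ 2 / 1) :* (T :* m) :- N) :* (con (+ 2 / 1) :* (T :* m) :+ N)) refl x T N (ℕ→ℚ M) δ))
    (0≤n/d 4 1 ⊠ (0≤ℕ→ℚ M ⊠ 0≤ℕ→ℚ M) ⊠ p≤q⇒0≤q-p xT²≤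
      ⊞ 0≤x ⊠ p≤q⇒0≤q-p N≤2MT ⊠ (≤-trans (<⇒≤ 0<N) N≤2MT ⊞ <⇒≤ 0<N)))

  zM≤N²⇒z≤ρN² : ∀ {z N} → z * ℕ→ℚ M ≤ N * N → z ≤ ρ * (N * N)
  zM≤N²⇒z≤ρN² {z} {N} zM≤N² = begin
    z                   ≡⟨ trans (sym (*-identityʳ z)) (cong (z *_) (sym ρM≡1)) ⟩
    z * (ρ * ℕ→ℚ M)     ≡⟨ solve 3 (λ z ρ m → z :* (ρ :* m) := ρ :* (z :* m)) refl z ρ (ℕ→ℚ M) ⟩
    ρ * (z * ℕ→ℚ M)     ≤⟨ *-monoˡ-≤-0≤ 0≤ρ zM≤N² ⟩
    ρ * (N * N)         ∎
    where open ≤-Reasoning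

  module ForGraph (n : ℕ) (2M≤n : 2 ℕ.* M ℕ.≤ n) (G : Graph n) (V₁ : Fin n → Bool) where

    T : ℕ
    T = n ℕ./ M

    open Partition G V₁
    open DegreeClasses T

    private
      TM≤n : T ℕ.* M ℕ.≤ n
      TM≤n = ℕ.m/n*n≤m n M

      n≤2TM : n ℕ.≤ 2 ℕ.* (T ℕ.* M)
      n≤2TM = begin
        n                   ≡⟨ ℕ.m≡m%n+[m/n]*n n M ⟩
        n ℕ.% M ℕ.+ T ℕ.* M ≤⟨ ℕ.+-monoˡ-≤ (T ℕ.* M) (ℕ.<⇒≤ (ℕ.m%n<n n M)) ⟩
        M ℕ.+ T ℕ.* M       ≤⟨ ℕ.+-monoˡ-≤ (T ℕ.* M) (ℕ.≤-trans (ℕ.≤-reflexive (sym (ℕ.*-identityˡ M))) (ℕ.*-monoˡ-≤ M 1≤T)) ⟩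
        T ℕ.* M ℕ.+ T ℕ.* M ≡⟨ cong (T ℕ.* M ℕ.+_) (ℕ.+-identityʳ (T ℕ.* M)) ⟨
        2 ℕ.* (T ℕ.* M)     ∎
        where
        open ℕ.≤-Reasoning
        1≤T : 1 ℕ.≤ T
        1≤T = ℕ.≤-trans (ℕ.≤-reflexive (sym (ℕ.n/n≡1 M)))
                (ℕ./-monoˡ-≤ M (ℕ.≤-trans (ℕ.m≤n+m M M) (ℕ.≤-trans (ℕ.≤-reflexive (cong (M ℕ.+_) (sym (ℕ.+-identityʳ M)))) 2M≤n)))

    l h l₂ h₂ : ℚ
    l  = ℕ→ℚ (# L₁)
    h  = ℕ→ℚ (# H₁)
    l₂ = ℕ→ℚ (# L₂)
    h₂ = ℕ→ℚ (# H₂)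

    open Extremal l h l₂ h₂ renaming (n to n′)

    private
      #V₁≡k : ℕ→ℚ (countFin n V₁) ≡ k
      #V₁≡k = trans (cong ℕ→ℚ (trans (countFin≡∑ n V₁) #V₁≡#L₁+#H₁)) (ℕ→ℚ-+ (# L₁) (# H₁))

      #V₂≡m : ℕ→ℚ (countFin n V₂) ≡ m
      #V₂≡m = trans (cong ℕ→ℚ (trans (countFin≡∑ n V₂) #V₂≡#L₂+#H₂)) (ℕ→ℚ-+ (# L₂) (# H₂))

      N≡n′ : ℕ→ℚ n ≡ n′
      N≡n′ = begin
        ℕ→ℚ n                                   ≡⟨ cong ℕ→ℚ (∑χ-complement n V₁) ⟨
        ℕ→ℚ (# V₁ ℕ.+ # V₂)                     ≡⟨ ℕ→ℚ-+ (# V₁) (# V₂) ⟩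
        ℕ→ℚ (# V₁) + ℕ→ℚ (# V₂)                 ≡⟨ cong₂ _+_ (trans (cong ℕ→ℚ (sym (countFin≡∑ n V₁))) #V₁≡k)
                                                             (trans (cong ℕ→ℚ (sym (countFin≡∑ n V₂))) #V₂≡m) ⟩
        n′                                      ∎
        where open ≡-Reasoning

      0≤k : 0ℚ ≤ k
      0≤k = 0≤ℕ→ℚ (# L₁) ⊞ 0≤ℕ→ℚ (# H₁)

      0≤m : 0ℚ ≤ m
      0≤m = 0≤ℕ→ℚ (# L₂) ⊞ 0≤ℕ→ℚ (# H₂)

      0<n′ : 0ℚ < n′
      0<n′ = subst (0ℚ <_) N≡n′ (<-≤-trans (positive⁻¹ 1ℚ) (ℕ→ℚ-mono-≤ {1} {n} (ℕ.≤-trans (s≤s z≤n) 2M≤n)))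

    e₁₁′ e₁₂′ e₂₂′ x₁′ x₂′ z′ r a′ : ℚ
    e₁₁′ = ℕ→ℚ e₁₁
    e₁₂′ = ℕ→ℚ e₁₂
    e₂₂′ = ℕ→ℚ e₂₂
    x₁′  = ℕ→ℚ x₁
    x₂′  = ℕ→ℚ x₂
    z′   = ℕ→ℚ (n ℕ.* T)
    r    = ρ * (n′ * n′)
    a′   = + 2 / 1 * v - + 3 / 1 + (v * v - u * u)

    private
      cast-≤ : ∀ {i j p q} → i ℕ.≤ j → ℕ→ℚ i ≡ p → ℕ→ℚ j ≡ q → p ≤ q
      cast-≤ i≤j i≡p j≡q = subst₂ _≤_ i≡p j≡q (ℕ→ℚ-mono-≤ i≤j)

      e₁₁′≤ : e₁₁′ ≤ l * l + + 2 / 1 * (x₁′ + z′)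
      e₁₁′≤ = cast-≤ e₁₁≤ refl (trans (ℕ→ℚ-+ (# L₁ ℕ.* # L₁) (2 ℕ.* (x₁ ℕ.+ n ℕ.* T))) (cong₂ _+_ (ℕ→ℚ-* (# L₁) (# L₁))
                (trans (ℕ→ℚ-* 2 (x₁ ℕ.+ n ℕ.* T)) (cong (+ 2 / 1 *_) (ℕ→ℚ-+ x₁ (n ℕ.* T))))))

      e₁₂′≤ : e₁₂′ ≤ h * h₂ + + 2 / 1 * z′
      e₁₂′≤ = cast-≤ e₁₂≤ refl (trans (ℕ→ℚ-+ (# H₁ ℕ.* # H₂) (2 ℕ.* (n ℕ.* T))) (cong₂ _+_ (ℕ→ℚ-* (# H₁) (# H₂)) (ℕ→ℚ-* 2 (n ℕ.* T))))

      e₂₂′≤ : e₂₂′ ≤ l₂ * m + h₂ * l₂ + x₂′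
      e₂₂′≤ = cast-≤ e₂₂≤ refl (trans (ℕ→ℚ-+ (# L₂ ℕ.* # V₂ ℕ.+ # H₂ ℕ.* # L₂) x₂)
                (cong (_+ x₂′) (trans (ℕ→ℚ-+ (# L₂ ℕ.* # V₂) (# H₂ ℕ.* # L₂)) (cong₂ _+_
                  (trans (ℕ→ℚ-* (# L₂) (# V₂)) (cong (l₂ *_) (trans (cong ℕ→ℚ (sym (countFin≡∑ n V₂))) #V₂≡m)))
                  (ℕ→ℚ-* (# H₂) (# L₂))))))

      z′≤r : z′ ≤ r
      z′≤r = subst (λ N → z′ ≤ ρ * (N * N)) N≡n′
        (zM≤N²⇒z≤ρN² {z′} {ℕ→ℚ n} (cast-≤ nTM≤n² (ℕ→ℚ-* (n ℕ.* T) M) (ℕ→ℚ-* n n)))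
        where
        nTM≤n² : n ℕ.* T ℕ.* M ℕ.≤ n ℕ.* n
        nTM≤n² = ℕ.≤-trans (ℕ.≤-reflexive (ℕ.*-assoc n T M)) (ℕ.*-monoʳ-≤ n TM≤n)

    module Hypotheses
      (paths₁≤ : + paths₁ G V₁ / 1 ≤ δ * (+ (n ^ 4) / 1))
      (paths₂≤ : + paths₂ G V₁ / 1 ≤ δ * (+ (n ^ 4) / 1))
      (size≤ : ιℕ (countFin n V₁) ⊖ γ ⊗ ιℕ n ≼ ι δ ⊗ ιℕ n)
      (size≥ : γ ⊗ ιℕ n ⊖ ιℕ (countFin n V₁) ≼ ι δ ⊗ ιℕ n)
      (sparse₂ : ιℕ (edgesIn G V₂) ≼ (α/2 ⊕ ι δ) ⊗ ιℕ (countFin n V₂ ^ 2))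
      where

      private
        x′≤r : ∀ x {P} → x ℕ.* (T ℕ.* T) ℕ.≤ P → + P / 1 ≤ δ * (+ (n ^ 4) / 1) → ℕ→ℚ x ≤ r
        x′≤r x {P} xT²≤P P≤δn⁴ = subst (λ N → ℕ→ℚ x ≤ ρ * (N * N)) N≡n′
          (xT²≤δN⁴⇒x≤ρN² (ℕ→ℚ x) (ℕ→ℚ T) (ℕ→ℚ n) (0≤ℕ→ℚ x) (subst (0ℚ <_) (sym N≡n′) 0<n′)
            (cast-≤ n≤2TM refl (trans (ℕ→ℚ-* 2 (T ℕ.* M)) (cong (+ 2 / 1 *_) (ℕ→ℚ-* T M))))
            (≤-trans (cast-≤ xT²≤P (trans (ℕ→ℚ-* x (T ℕ.* T)) (cong (ℕ→ℚ x *_) (ℕ→ℚ-* T T))) refl)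
                     (subst (λ q → ℕ→ℚ P ≤ δ * q) (ℕ→ℚ-^4 n) P≤δn⁴)))

        x₁′≤r : x₁′ ≤ r
        x₁′≤r = x′≤r x₁ x₁T²≤paths₁ paths₁≤

        x₂′≤r : x₂′ ≤ r
        x₂′≤r = x′≤r x₂ x₂T²≤paths₂ paths₂≤

        2k≤ : + 2 / 1 * k ≤ (+ 3 / 1 - u) * n′
        2k≤ = subst₂ (λ K N → + 2 / 1 * K ≤ (+ 3 / 1 - u) * N) #V₁≡k N≡n′
          (≼⇒2k≤ δ (ℕ→ℚ n) (0≤ℕ→ℚ n) (ℕ→ℚ (countFin n V₁)) s-lower size≤)

        2k≥ : (+ 3 / 1 - v) * n′ ≤ + 2 / 1 * k
        2k≥ = subst₂ (λ K N → (+ 3 / 1 - v) * N ≤ + 2 / 1 * K) #V₁≡k N≡n′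
          (≼⇒≤2k δ (ℕ→ℚ n) (0≤ℕ→ℚ n) (ℕ→ℚ (countFin n V₁)) t-upper size≥)

        e₂₂′≤am² : e₂₂′ ≤ (+ 2 / 1 * v - + 3 / 1) * (m * m)
        e₂₂′≤am² = subst₂ (λ E Q → E ≤ (+ 2 / 1 * v - + 3 / 1) * Q)
          (trans (sym (ℕ→ℚ-* 2 (edgesIn G V₂))) (cong ℕ→ℚ (2*edgesIn V₂)))
          (trans (ℕ→ℚ-^2 (countFin n V₂)) (cong₂ _*_ #V₂≡m #V₂≡m))
          (≼⇒2e≤ δ (ℕ→ℚ (countFin n V₂ ^ 2)) (ℕ→ℚ (edgesIn G V₂)) (<⇒≤ 0<δ) (0≤ℕ→ℚ (countFin n V₂ ^ 2)) t-upper sparse₂)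

        k²+e₂₂′≤an² : k * k + e₂₂′ ≤ a′ * (n′ * n′)
        k²+e₂₂′≤an² = SizeBracket.k²+e≤ u-lower v-upper 0≤k 0≤m 2k≤ e₂₂′≤am²

        2km≤an² : + 2 / 1 * (k * m) ≤ a′ * (n′ * n′)
        2km≤an² = ≤-trans (SizeBracket.2km≤ u-lower v-upper v≤2 0≤k 0≤m 2k≥)
          (*-monoʳ-≤-0≤ (0≤p*p n′) (p≤p+q {+ 2 / 1 * v - + 3 / 1} {v * v - u * u} (p≤q⇒0≤q-p u²≤v²)))
          where
          v≤2 : v ≤ + 2 / 1
          v≤2 = ≤-trans v≤9/5 (toWitness {a? = + 9 / 5 ≤? + 2 / 1} tt)
          u²≤v² : u * u ≤ v * v
          u²≤v² = square-mono-≤ (LowerSqrt3.nonNeg u-lower) (SizeBracket.u≤v u-lower v-upper)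

        3n≤5k : + 3 / 1 * n′ ≤ + 5 / 1 * k
        3n≤5k = ≤-by-gap _
          (solve 3 (λ k n v → con (+ 5 / 1) :* k :- con (+ 3 / 1) :* n
            := con (+ 5 / 2) :* (con (+ 2 / 1) :* k :- (con (+ 3 / 1) :- v) :* n) :+ con (+ 5 / 2) :* n :* (con (+ 9 / 5) :- v))
            refl k n′ v)
          (0≤n/d 5 2 ⊠ p≤q⇒0≤q-p 2k≥ ⊞ 0≤n/d 5 2 ⊠ <⇒≤ 0<n′ ⊠ p≤q⇒0≤q-p v≤9/5)

      open Bounds e₁₁′ e₁₂′ e₂₂′ x₁′ x₂′ z′ r a′ (0≤ℕ→ℚ (# L₁)) (0≤ℕ→ℚ (# H₁)) (0≤ℕ→ℚ (# L₂)) (0≤ℕ→ℚ (# H₂))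
        e₁₁′≤ e₁₂′≤ e₂₂′≤ x₁′≤r x₂′≤r z′≤r (0≤ρ ⊠ 0≤p*p n′) k²+e₂₂′≤an² 2km≤an²

      private
        n²≡ : ℕ→ℚ (n ^ 2) ≡ n′ * n′
        n²≡ = trans (ℕ→ℚ-^2 n) (cong₂ _*_ N≡n′ N≡n′)

        2E≡ : + 2 / 1 * ℕ→ℚ (edges G) ≡ e₁₁′ + + 2 / 1 * e₁₂′ + e₂₂′
        2E≡ = begin
          + 2 / 1 * ℕ→ℚ (edges G)              ≡⟨ ℕ→ℚ-* 2 (edges G) ⟨
          ℕ→ℚ (2 ℕ.* edges G)                  ≡⟨ cong ℕ→ℚ 2*edges ⟩
          ℕ→ℚ (e₁₁ ℕ.+ 2 ℕ.* e₁₂ ℕ.+ e₂₂)      ≡⟨ trans (ℕ→ℚ-+ (e₁₁ ℕ.+ 2 ℕ.* e₁₂) e₂₂)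
                                                   (cong (_+ e₂₂′) (trans (ℕ→ℚ-+ e₁₁ (2 ℕ.* e₁₂)) (cong (λ x → e₁₁′ + x) (ℕ→ℚ-* 2 e₁₂)))) ⟩
          e₁₁′ + + 2 / 1 * e₁₂′ + e₂₂′          ∎
          where open ≡-Reasoning

        halve : ∀ {p q} → + 2 / 1 * p ≤ + 2 / 1 * q → p ≤ q
        halve = *-cancelˡ-≤-0< (positive⁻¹ (+ 2 / 1))

        total≤ : e₁₁′ + + 2 / 1 * e₁₂′ + e₂₂′ ≤ (+ 2 / 1 * u - + 3 / 1 + + 2 / 1 * ξ) * (n′ * n′)
        total≤ = ≤-trans (edge-bound 3n≤5k 0<n′) (≤-by-gap _
          (solve 5 (λ u ξ ρ A N → (con (+ 2 / 1) :* u :- con (+ 3 / 1) :+ con (+ 2 / 1) :* ξ) :* (N :* N)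
                                   :- (A :* (N :* N) :+ con (+ 9 / 1) :* (ρ :* (N :* N)))
            := (con (+ 2 / 1) :* ξ :- con (+ 21 / 1) :* ρ) :* (N :* N)
               :+ (con (+ 21 / 1) :* ρ :- (A :- (con (+ 2 / 1) :* u :- con (+ 3 / 1)) :+ con (+ 9 / 1) :* ρ)) :* (N :* N))
            refl u ξ ρ a′ n′)
          (p≤q⇒0≤q-p total-slack ⊠ 0≤p*p n′ ⊞ p≤q⇒0≤q-p bracket-defect ⊠ 0≤p*p n′))

      edges-bound : ιℕ (edges G) ≼ (α/2 ⊕ ι ξ) ⊗ ιℕ (n ^ 2)
      edges-bound = 2e≤⇒≼ ξ (ℕ→ℚ (n ^ 2)) (ℕ→ℚ (edges G)) u-lower (0≤ℕ→ℚ (n ^ 2))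
        (subst₂ (λ E Q → E ≤ (+ 2 / 1 * u - + 3 / 1 + + 2 / 1 * ξ) * Q) (sym 2E≡) (sym n²≡) total≤)

      private
        b : ℚ
        b = + 2 / 1 * u - + 3 / 1

        b≤ : (α/2 ⊖ ι δ) ⊗ ιℕ (n ^ 2) ≼ ιℕ (edges G) → b * (n′ * n′) ≤ e₁₁′ + + 2 / 1 * e₁₂′ + e₂₂′
        b≤ dense = subst₂ (λ Q E → b * Q ≤ E) n²≡ 2E≡
          (≼⇒≤2e δ (ℕ→ℚ (n ^ 2)) (ℕ→ℚ (edges G)) (<⇒≤ 0<δ) (0≤ℕ→ℚ (n ^ 2)) s-lower dense)

        defect≤ : defect b ≤ + 21 / 1 * ρ * (n′ * n′)
        defect≤ = ≤-by-gap _
          (solve 4 (λ A b ρ N → con (+ 21 / 1) :* ρ :* (N :* N) :- ((A :- b) :* (N :* N) :+ con (+ 9 / 1) :* (ρ :* (N :* N)))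
            := (con (+ 21 / 1) :* ρ :- (A :- b :+ con (+ 9 / 1) :* ρ)) :* (N :* N)) refl a′ b ρ n′)
          (p≤q⇒0≤q-p bracket-defect ⊠ 0≤p*p n′)

        0<θ : 0ℚ < θ
        0<θ = *-pres-0< 0<ε (positive⁻¹ (+ 1 / 5))

        0≤θ : 0ℚ ≤ θ
        0≤θ = <⇒≤ 0<θ

        θ≤1/5 : θ ≤ + 1 / 5
        θ≤1/5 = subst (θ ≤_) (*-identityˡ (+ 1 / 5)) (*-monoʳ-≤-0≤ (0≤n/d 1 5) ε≤1)

        E₁+E₂≡ : ℕ→ℚ (edgesIn G V₁ ℕ.+ edgesIn G V₂) ≡ (e₁₁′ + e₂₂′) * ½
        E₁+E₂≡ = begin
          ℕ→ℚ (edgesIn G V₁ ℕ.+ edgesIn G V₂)                      ≡⟨ ℕ→ℚ-+ (edgesIn G V₁) (edgesIn G V₂) ⟩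
          E₁ + E₂                                                  ≡⟨ solve 2 (λ x y → x :+ y := (con (+ 2 / 1) :* x :+ con (+ 2 / 1) :* y) :* con ½) refl E₁ E₂ ⟩
          (+ 2 / 1 * E₁ + + 2 / 1 * E₂) * ½                        ≡⟨ cong (_* ½) (cong₂ _+_ (2Eᵢ≡ V₁) (2Eᵢ≡ V₂)) ⟩
          (e₁₁′ + e₂₂′) * ½                                        ∎
          where
          open ≡-Reasoning
          E₁ E₂ : ℚ
          E₁ = ℕ→ℚ (edgesIn G V₁)
          E₂ = ℕ→ℚ (edgesIn G V₂)
          2Eᵢ≡ : ∀ S → + 2 / 1 * ℕ→ℚ (edgesIn G S) ≡ ℕ→ℚ (pairs (λ i j → adj G i j ∧ S i ∧ S j))
          2Eᵢ≡ S = trans (sym (ℕ→ℚ-* 2 (edgesIn G S))) (cong ℕ→ℚ (2*edgesIn S))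

        crossing-edges-few : (α/2 ⊖ ι δ) ⊗ ιℕ (n ^ 2) ≼ ιℕ (edges G) → θ * n′ < l →
          + edgesBetween G V₁ / 1 ≤ ξ * (+ (n ^ 2) / 1)
        crossing-edges-few dense θn<l = subst₂ (λ E Q → E ≤ ξ * Q) (cong ℕ→ℚ (sym edgesBetween≡e₁₂)) (sym n²≡)
          (*-cancelˡ-≤-0< 0<θ (begin
            θ * e₁₂′                                   ≤⟨ few-crossing-edges 3n≤5k 0<n′ (b≤ dense) 0≤θ θn<l ⟩
            defect b + + 2 / 1 * θ * r                 ≤⟨ ≤-by-gap _
              (solve 5 (λ θ ξ ρ d N → θ :* (ξ :* (N :* N)) :- (d :+ con (+ 2 / 1) :* θ :* (ρ :* (N :* N)))
                := (θ :* ξ :- (con (+ 21 / 1) :* ρ :+ con (+ 2 / 1) :* θ :* ρ)) :* (N :* N)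
                   :+ (con (+ 21 / 1) :* ρ :* (N :* N) :- d)) refl θ ξ ρ (defect b) n′)
              (p≤q⇒0≤q-p crossing-slack ⊠ 0≤p*p n′ ⊞ p≤q⇒0≤q-p defect≤) ⟩
            θ * (ξ * (n′ * n′))                        ∎))
          where open ≤-Reasoning

        inner-edges-few : (α/2 ⊖ ι δ) ⊗ ιℕ (n ^ 2) ≼ ιℕ (edges G) → l ≤ θ * n′ →
          + (edgesIn G V₁ ℕ.+ edgesIn G V₂) / 1 ≤ ξ * (+ (n ^ 2) / 1)
        inner-edges-few dense l≤θn = subst₂ (λ E Q → E ≤ ξ * Q) (sym E₁+E₂≡) (sym n²≡) (halve (begin
            + 2 / 1 * ((e₁₁′ + e₂₂′) * ½)              ≡⟨ solve 1 (λ e → con (+ 2 / 1) :* (e :* con ½) := e) refl (e₁₁′ + e₂₂′) ⟩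
            e₁₁′ + e₂₂′                                ≤⟨ few-inner-edges 3n≤5k 0<n′ (b≤ dense) θ≤1/5 l≤θn ⟩
            θ * θ * (n′ * n′) + + 5 / 1 * r + + 25 / 2 * defect b
                                                       ≤⟨ ≤-by-gap _
              (solve 5 (λ θ ξ ρ d N → con (+ 2 / 1) :* (ξ :* (N :* N))
                                       :- (θ :* θ :* (N :* N) :+ con (+ 5 / 1) :* (ρ :* (N :* N)) :+ con (+ 25 / 2) :* d)
                := (con (+ 2 / 1) :* ξ :- (θ :* θ :+ con (+ 5 / 1) :* ρ :+ con (+ 25 / 2) :* (con (+ 21 / 1) :* ρ))) :* (N :* N)
                   :+ con (+ 25 / 2) :* (con (+ 21 / 1) :* ρ :* (N :* N) :- d)) refl θ ξ ρ (defect b) n′)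
              (p≤q⇒0≤q-p inner-slack ⊠ 0≤p*p n′ ⊞ 0≤n/d 25 2 ⊠ p≤q⇒0≤q-p defect≤) ⟩
            + 2 / 1 * (ξ * (n′ * n′))                  ∎))
          where open ≤-Reasoning

      stability : (α/2 ⊖ ι δ) ⊗ ιℕ (n ^ 2) ≼ ιℕ (edges G) →
        (+ edgesBetween G V₁ / 1 ≤ ξ * (+ (n ^ 2) / 1))
        ⊎ (+ (edgesIn G V₁ ℕ.+ edgesIn G V₂) / 1 ≤ ξ * (+ (n ^ 2) / 1))
      stability dense =
        Sum.map (crossing-edges-few dense ∘ ≰⇒>) (inner-edges-few dense) (Sum.swap (toSum (l ≤? θ * n′)))

proposition6p1 :
    (ξ : ℚ) → 0ℚ < ξ →
    Σ ℚ λ δ → 0ℚ < δ × Σ ℕ λ n₀ →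
      (n : ℕ) → n₀ Data.Nat.≤ n →
      (G : Graph n) (V₁ : Fin n → Bool) →
      (+ paths₁ G V₁ / 1) ≤ δ * (+ (n ^ 4) / 1) →
      (+ paths₂ G V₁ / 1) ≤ δ * (+ (n ^ 4) / 1) →
      ιℕ (countFin n V₁) ⊖ (γ ⊗ ιℕ n) ≼ ι δ ⊗ ιℕ n →
      (γ ⊗ ιℕ n) ⊖ ιℕ (countFin n V₁) ≼ ι δ ⊗ ιℕ n →
      ιℕ (edgesIn G (λ v → not (V₁ v)))
        ≼ (α/2 ⊕ ι δ) ⊗ ιℕ (countFin n (λ v → not (V₁ v)) ^ 2) →
      (ιℕ (edges G) ≼ (α/2 ⊕ ι ξ) ⊗ ιℕ (n ^ 2))
      × ((α/2 ⊖ ι δ) ⊗ ιℕ (n ^ 2) ≼ ιℕ (edges G) →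
         ((+ edgesBetween G V₁ / 1) ≤ ξ * (+ (n ^ 2) / 1))
         ⊎ ((+ (edgesIn G V₁ Data.Nat.+ edgesIn G (λ v → not (V₁ v))) / 1)
              ≤ ξ * (+ (n ^ 2) / 1)))
proposition6p1 ξ 0<ξ = δ , 0<δ , 2 ℕ.* M ,
  λ n 2M≤n G V₁ paths₁≤ paths₂≤ size≤ size≥ sparse₂ →
    let open ForGraph.Hypotheses n 2M≤n G V₁ paths₁≤ paths₂≤ size≤ size≥ sparse₂
    in  edges-bound , stability
  where open Proof ξ 0<ξ
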